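{- Let $m>n\geq1$ be coprime integers and define $$\mathcal{A}_{\frac{m}{n}}(q)=q\,\mathcal{N}_{\frac{m}{n}}(q)\mathcal{N}_{\frac{n}{m}}(q)+\mathcal{D}_{\frac{m}{n}}(q)\mathcal{D}_{\frac{n}{m}}(q),$$ $$\mathcal{B}_{\frac{m}{n}}(q)=\mathcal{N}_{\frac{m}{n}}(q)\mathcal{D}_{\frac{n}{m}}(q)-\mathcal{D}_{\frac{m}{n}}(q)\mathcal{N}_{\frac{n}{m}}(q),$$ $$\mathcal{C}_{\frac{m}{n}}(q)=q\,\mathcal{N}_{\frac{m}{n}}(q)^2+\mathcal{D}_{\frac{m}{n}}(q)^2.$$ Then: (i) the polynomials $\mathcal{A}_{\frac{m}{n}}$ and $\mathcal{B}_{\frac{m}{n}}$ are self-reciprocal, i.e. $q^{\deg P}P(q^{ -1})=P(q)$ for $P\in\{\mathcal{A}_{\frac{m}{n}},\mathcal{B}_{\frac{m}{n}}\}$; (ii) all three polynomials $\mathcal{A}_{\frac{m}{n}},\mathcal{B}_{\frac{m}{n}},\mathcal{C}_{\frac{m}{n}}$ are monic (their leading coefficient and lowest-degree coefficient are both equal to $1$) and have positive integer coefficients.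
   Context: $q$-rationals: for every rational $x$ the $q$-rational $[x]_q$ is the rational function of $q$ uniquely determined by $[0]_q=0$ and the rules $[x+1]_q=q[x]_q+1$ and $[-1/x]_q=-1/(q[x]_q)$. For a positive rational $x$, $\mathcal{N}_x(q)$ and $\mathcal{D}_x(q)$ denote the coprime polynomials in $\mathbb{Z}[q]$ with $[x]_q=\mathcal{N}_x(q)/\mathcal{D}_x(q)$ and $\mathcal{D}_x(0)=1$. -}

module Defs where

open import Data.Nat as ℕ using (ℕ; zero; suc; _∸_)
open import Data.Nat.DivMod using (_/_; _%_)
open import Data.Integer as ℤ using (ℤ; 0ℤ; 1ℤ)
open import Data.List using (List; []; _∷_; map; replicate)
open import Data.Product using (_×_; _,_; ∃-syntax)
open import Relation.Binary.PropositionalEquality using (_≡_; _≢_)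

-- Polynomials in ℤ[q], represented by coefficient lists
-- (lowest degree first; trailing zeros allowed, equality is semantic).

Poly : Set
Poly = List ℤ

coeff : Poly → ℕ → ℤ
coeff []       _       = 0ℤ
coeff (a ∷ _)  zero    = a
coeff (_ ∷ p)  (suc k) = coeff p k

infix 4 _≈ᴾ_
_≈ᴾ_ : Poly → Poly → Set
p ≈ᴾ r = ∀ k → coeff p k ≡ coeff r k

infixl 6 _+ᴾ_ _-ᴾ_
infixl 7 _*ᴾ_

_+ᴾ_ : Poly → Poly → Poly
[]      +ᴾ r       = r
(a ∷ p) +ᴾ []      = a ∷ p
(a ∷ p) +ᴾ (b ∷ r) = (a ℤ.+ b) ∷ (p +ᴾ r)

-ᴾ_ : Poly → Poly
-ᴾ p = map ℤ.-_ p

_-ᴾ_ : Poly → Poly → Poly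
p -ᴾ r = p +ᴾ (-ᴾ r)

qᴾ* : Poly → Poly
qᴾ* p = 0ℤ ∷ p

_*ᴾ_ : Poly → Poly → Poly
[]      *ᴾ r = []
(a ∷ p) *ᴾ r = map (a ℤ.*_) r +ᴾ qᴾ* (p *ᴾ r)

0ᴾ 1ᴾ : Poly
0ᴾ = []
1ᴾ = 1ℤ ∷ []

_∣ᴾ_ : Poly → Poly → Set
r ∣ᴾ p = ∃[ s ] (r *ᴾ s ≈ᴾ p)

Coprimeᴾ : Poly → Poly → Set
Coprimeᴾ p r = ∀ u → u ∣ᴾ p → u ∣ᴾ r → u ∣ᴾ 1ᴾ

IsDegree : Poly → ℕ → Set
IsDegree p d = (coeff p d ≢ 0ℤ) × (∀ k → d ℕ.< k → coeff p k ≡ 0ℤ)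

SelfReciprocal : Poly → Set
SelfReciprocal p = ∃[ d ] (IsDegree p d × (∀ k → k ℕ.≤ d → coeff p k ≡ coeff p (d ∸ k)))

MonicPositive : Poly → Set
MonicPositive p = ∃[ d ] (IsDegree p d × coeff p d ≡ 1ℤ × coeff p 0 ≡ 1ℤ
                          × (∀ k → k ℕ.≤ d → 0ℤ ℤ.< coeff p k))

-- q-rationals as (unreduced) fractions P/Q of polynomials, computed
-- literally from the defining rules
--   [0]_q = 0,  [x+1]_q = q[x]_q + 1,  [-1/x]_q = -1/(q[x]_q).

RatFun : Set
RatFun = Poly × Poly   -- (numerator , denominator)

-- x ↦ x + 1 :  P/Q ↦ (qP + Q)/Q
Tq : RatFun → RatFun
Tq (P , Q) = (qᴾ* P +ᴾ Q , Q)

-- x ↦ x - 1 (inverse of the rule above): P/Q ↦ (P - Q)/(qQ)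
Tq⁻¹ : RatFun → RatFun
Tq⁻¹ (P , Q) = (P -ᴾ Q , qᴾ* Q)

-- x ↦ -1/x :  P/Q ↦ -Q/(qP)
Sq : RatFun → RatFun
Sq (P , Q) = (-ᴾ Q , qᴾ* P)

iter : ℕ → (RatFun → RatFun) → RatFun → RatFun
iter zero    f x = x
iter (suc n) f x = f (iter n f x)

zeroRF : RatFun
zeroRF = (0ᴾ , 1ᴾ)

-- go fuel p d = [p/d]_q for p ≥ 0, d ≥ 1 (fuel ≥ d suffices).
-- Write p = j d + r.  If r = 0 then [p/d] = T^j [0].
-- Otherwise [p/d] = T^j [r/d], [r/d] = S [-d/r], and with
-- k = ⌈d/r⌉, s = k r - d (0 ≤ s < r): [-d/r] = T^{-k} [s/r].
go : ℕ → ℕ → ℕ → RatFun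
go zero    p d       = zeroRF
go (suc f) p zero    = zeroRF
go (suc f) p (suc d') with p % suc d'
... | zero   = iter (p / suc d') Tq zeroRF
... | suc r' = iter (p / suc d') Tq
                 (Sq (iter k Tq⁻¹ (go f s (suc r'))))
  where
    k : ℕ
    k = (suc d' ℕ.+ r') / suc r'
    s : ℕ
    s = k ℕ.* suc r' ∸ suc d'

qrat : ℕ → ℕ → RatFun
qrat p d = go (suc d) p d

IsNumDen : ℕ → ℕ → Poly → Poly → Set
IsNumDen p d N D = let (P , Q) = qrat p d in
  (N *ᴾ Q ≈ᴾ D *ᴾ P) × Coprimeᴾ N D × coeff D 0 ≡ 1ℤ

𝒜 : Poly → Poly → Poly → Poly → Poly
𝒜 N₁ D₁ N₂ D₂ = qᴾ* (N₁ *ᴾ N₂) +ᴾ D₁ *ᴾ D₂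

ℬ : Poly → Poly → Poly → Poly → Poly
ℬ N₁ D₁ N₂ D₂ = N₁ *ᴾ D₂ -ᴾ D₁ *ᴾ N₂

𝒞 : Poly → Poly → Poly
𝒞 N₁ D₁ = qᴾ* (N₁ *ᴾ N₁) +ᴾ D₁ *ᴾ D₁

{-# OPTIONS --safe #-}
-- For p, d ≥ 1 the subtractive Euclidean algorithm computes the reduced
-- fractions N/D of [p/d]_q and N̄/D̄ of [d/p]_q together: passing from (p, d)
-- to (p + d, d) replaces N/D by (qN + D)/D and N̄/D̄ by qN̄/(qN̄ + D̄), starting
-- from 1/1 at p = d.  Along the way one keeps track of
--   * a relation aD − cN = qᵏ, which together with D(0) = 1 shows that N/D is
--     the coprime representation of [p/d]_q (the literal recursion through
--     x ↦ x − 1 and x ↦ −1/x reaches it only up to a factor (−q)ᵃ);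
--   * the ranges where N, D, N̄, D̄ have positive coefficients, with extreme
--     coefficients 1;
--   * the symmetries q²ᵉ(NN̄)(q⁻¹) = DD̄, q²ᵉ(ND̄)(q⁻¹) = ND̄ and
--     q²ᵉ(DN̄)(q⁻¹) = DN̄, where e is the common degree of N and N̄.
-- The last ones make 𝒜 = qNN̄ + DD̄ and ℬ = ND̄ − DN̄ palindromic.  Positivity of
-- 𝒜 and 𝒞 is read off the ranges; for ℬ one goes back one step (m > n):
-- with (N, D, N̄, D̄) = (qN₀ + D₀, D₀, qN̄₀, qN̄₀ + D̄₀) it is
-- q²N₀N̄₀ + qN₀D̄₀ + D₀D̄₀, a sum without cancellation.
module Submission where

open import Defs
open import Data.Nat using (ℕ; zero; suc; _+_; _*_; _∸_; _≤_; _<_; z≤n; s≤s; NonZero)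
import Data.Nat.Properties as ℕₚ
open import Data.Nat.Coprimality using (Coprime) renaming (sym to Coprime-sym)
open import Data.Nat.Divisibility using (_∣_; _∣0; ∣-refl; ∣n∣m%n⇒∣m; m%n≡0⇒n∣m; ∣n⇒∣m*n; ∣m+n∣m⇒∣n)
open import Data.Nat.DivMod using (_/_; _%_; m≡m%n+[m/n]*n; m%n<n; m/n*n≤m; n/1≡n)
open import Data.Integer as ℤ using (ℤ; 0ℤ; 1ℤ) renaming (_+_ to _+ℤ_; _*_ to _*ℤ_; -_ to -ℤ_)
import Data.Integer.Properties as ℤₚ
open import Data.List using ([]; _∷_; map)
open import Data.Maybe using (Maybe; just; nothing)
open import Data.Product using (Σ; _×_; _,_; proj₁; proj₂; swap)
open import Data.Sum using (_⊎_; inj₁; inj₂; [_,_]′)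
open import Data.Empty using (⊥-elim)
open import Algebra.Bundles using (CommutativeRing)
import Algebra.Solver.Ring.AlmostCommutativeRing as ACR
open import Relation.Binary.Bundles using (Setoid)
import Relation.Binary.Reasoning.Setoid
open import Relation.Binary.Structures using (IsEquivalence)
open import Relation.Binary.PropositionalEquality
open import Relation.Nullary using (yes; no)
open import Relation.Binary.Definitions using (Tri; tri<; tri≈; tri>)
open import Function using (_∘_)

-- The commutative ring ℤ[q]

coeff-+ᴾ : ∀ p r k → coeff (p +ᴾ r) k ≡ coeff p k +ℤ coeff r k
coeff-+ᴾ []      r       k       = sym (ℤₚ.+-identityˡ _)
coeff-+ᴾ (a ∷ p) []      k       = sym (ℤₚ.+-identityʳ _)
coeff-+ᴾ (a ∷ p) (b ∷ r) zero    = refl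
coeff-+ᴾ (a ∷ p) (b ∷ r) (suc k) = coeff-+ᴾ p r k

coeff-scale : ∀ a r k → coeff (map (a *ℤ_) r) k ≡ a *ℤ coeff r k
coeff-scale a []      k       = sym (ℤₚ.*-zeroʳ a)
coeff-scale a (b ∷ r) zero    = refl
coeff-scale a (b ∷ r) (suc k) = coeff-scale a r k

coeff-negᴾ : ∀ p k → coeff (-ᴾ p) k ≡ -ℤ coeff p k
coeff-negᴾ []      k       = refl
coeff-negᴾ (a ∷ p) zero    = refl
coeff-negᴾ (a ∷ p) (suc k) = coeff-negᴾ p k

-- _≈ᴾ_ wrapped in a record, so that both polynomials can be inferred
-- from a proof.
infix 4 _≋_
record _≋_ (p r : Poly) : Set where
  constructor mk≋
  field coeff-≡ : p ≈ᴾ r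
open _≋_ public

≋-refl : ∀ {p} → p ≋ p
≋-refl = mk≋ λ _ → refl

≋-sym : ∀ {p r} → p ≋ r → r ≋ p
≋-sym (mk≋ h) = mk≋ λ k → sym (h k)

≋-trans : ∀ {p r s} → p ≋ r → r ≋ s → p ≋ s
≋-trans (mk≋ h) (mk≋ g) = mk≋ λ k → trans (h k) (g k)

≋-isEquivalence : IsEquivalence _≋_
≋-isEquivalence = record { refl = ≋-refl ; sym = ≋-sym ; trans = ≋-trans }

≋-setoid : Setoid _ _
≋-setoid = record { isEquivalence = ≋-isEquivalence }

module ≋-Reasoning = Relation.Binary.Reasoning.Setoid ≋-setoid

+ᴾ-cong : ∀ {p p′ r r′} → p ≋ p′ → r ≋ r′ → p +ᴾ r ≋ p′ +ᴾ r′
+ᴾ-cong {p} {p′} {r} {r′} (mk≋ h) (mk≋ g) = mk≋ λ k →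
  trans (coeff-+ᴾ p r k) (trans (cong₂ _+ℤ_ (h k) (g k)) (sym (coeff-+ᴾ p′ r′ k)))

-ᴾ-cong : ∀ {p p′} → p ≋ p′ → -ᴾ p ≋ -ᴾ p′
-ᴾ-cong {p} {p′} (mk≋ h) = mk≋ λ k →
  trans (coeff-negᴾ p k) (trans (cong -ℤ_ (h k)) (sym (coeff-negᴾ p′ k)))

qᴾ*-cong : ∀ {p p′} → p ≋ p′ → qᴾ* p ≋ qᴾ* p′
qᴾ*-cong (mk≋ h) = mk≋ λ { zero → refl ; (suc k) → h k }

+ᴾ-comm : ∀ p r → p +ᴾ r ≋ r +ᴾ p
+ᴾ-comm p r = mk≋ λ k →
  trans (coeff-+ᴾ p r k) (trans (ℤₚ.+-comm (coeff p k) _) (sym (coeff-+ᴾ r p k)))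

+ᴾ-assoc : ∀ p r s → (p +ᴾ r) +ᴾ s ≋ p +ᴾ (r +ᴾ s)
+ᴾ-assoc p r s = mk≋ λ k → begin
  coeff ((p +ᴾ r) +ᴾ s) k                 ≡⟨ coeff-+ᴾ (p +ᴾ r) s k ⟩
  coeff (p +ᴾ r) k +ℤ coeff s k           ≡⟨ cong (_+ℤ coeff s k) (coeff-+ᴾ p r k) ⟩
  coeff p k +ℤ coeff r k +ℤ coeff s k     ≡⟨ ℤₚ.+-assoc (coeff p k) (coeff r k) (coeff s k) ⟩
  coeff p k +ℤ (coeff r k +ℤ coeff s k)   ≡⟨ cong (coeff p k +ℤ_) (coeff-+ᴾ r s k) ⟨
  coeff p k +ℤ coeff (r +ᴾ s) k           ≡⟨ coeff-+ᴾ p (r +ᴾ s) k ⟨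
  coeff (p +ᴾ (r +ᴾ s)) k                 ∎
  where open ≡-Reasoning

+ᴾ-identityʳ : ∀ p → p +ᴾ 0ᴾ ≋ p
+ᴾ-identityʳ p = mk≋ λ k → trans (coeff-+ᴾ p [] k) (ℤₚ.+-identityʳ _)

+ᴾ-inverseʳ : ∀ p → p +ᴾ (-ᴾ p) ≋ 0ᴾ
+ᴾ-inverseʳ p = mk≋ λ k →
  trans (coeff-+ᴾ p (-ᴾ p) k) (trans (cong (coeff p k +ℤ_) (coeff-negᴾ p k)) (ℤₚ.+-inverseʳ (coeff p k)))

+ᴾ-leftComm : ∀ x y z → x +ᴾ (y +ᴾ z) ≋ y +ᴾ (x +ᴾ z)
+ᴾ-leftComm x y z = ≋-trans (≋-sym (+ᴾ-assoc x y z))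
  (≋-trans (+ᴾ-cong (+ᴾ-comm x y) ≋-refl) (+ᴾ-assoc y x z))

+ᴾ-interchange : ∀ w x y z → (w +ᴾ x) +ᴾ (y +ᴾ z) ≋ (w +ᴾ y) +ᴾ (x +ᴾ z)
+ᴾ-interchange w x y z = ≋-trans (+ᴾ-assoc w x (y +ᴾ z))
  (≋-trans (+ᴾ-cong (≋-refl {w}) (+ᴾ-leftComm x y z)) (≋-sym (+ᴾ-assoc w y (x +ᴾ z))))

qᴾ*-distrib-+ᴾ : ∀ r r′ → qᴾ* (r +ᴾ r′) ≋ qᴾ* r +ᴾ qᴾ* r′
qᴾ*-distrib-+ᴾ r r′ = mk≋ λ { zero → refl ; (suc k) → refl }

scale-distrib-+ᴾ : ∀ a r r′ → map (a *ℤ_) (r +ᴾ r′) ≋ map (a *ℤ_) r +ᴾ map (a *ℤ_) r′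
scale-distrib-+ᴾ a r r′ = mk≋ λ k → begin
  coeff (map (a *ℤ_) (r +ᴾ r′)) k            ≡⟨ coeff-scale a (r +ᴾ r′) k ⟩
  a *ℤ coeff (r +ᴾ r′) k                     ≡⟨ cong (a *ℤ_) (coeff-+ᴾ r r′ k) ⟩
  a *ℤ (coeff r k +ℤ coeff r′ k)             ≡⟨ ℤₚ.*-distribˡ-+ a (coeff r k) (coeff r′ k) ⟩
  a *ℤ coeff r k +ℤ a *ℤ coeff r′ k          ≡⟨ cong₂ _+ℤ_ (coeff-scale a r k) (coeff-scale a r′ k) ⟨
  coeff (map (a *ℤ_) r) k +ℤ coeff (map (a *ℤ_) r′) k
                                             ≡⟨ coeff-+ᴾ (map (a *ℤ_) r) (map (a *ℤ_) r′) k ⟨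
  coeff (map (a *ℤ_) r +ᴾ map (a *ℤ_) r′) k  ∎
  where open ≡-Reasoning

scale-zero : ∀ r → map (0ℤ *ℤ_) r ≋ 0ᴾ
scale-zero r = mk≋ λ k → trans (coeff-scale 0ℤ r k) (ℤₚ.*-zeroˡ (coeff r k))

scale-one : ∀ r → map (1ℤ *ℤ_) r ≋ r
scale-one r = mk≋ λ k → trans (coeff-scale 1ℤ r k) (ℤₚ.*-identityˡ (coeff r k))

scale-qᴾ* : ∀ a r → map (a *ℤ_) (qᴾ* r) ≋ qᴾ* (map (a *ℤ_) r)
scale-qᴾ* a r = mk≋ λ { zero → ℤₚ.*-zeroʳ a ; (suc k) → refl }

scale-scale : ∀ a b r → map (a *ℤ_) (map (b *ℤ_) r) ≋ map ((a *ℤ b) *ℤ_) r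
scale-scale a b r = mk≋ λ k → begin
  coeff (map (a *ℤ_) (map (b *ℤ_) r)) k  ≡⟨ coeff-scale a (map (b *ℤ_) r) k ⟩
  a *ℤ coeff (map (b *ℤ_) r) k           ≡⟨ cong (a *ℤ_) (coeff-scale b r k) ⟩
  a *ℤ (b *ℤ coeff r k)                  ≡⟨ ℤₚ.*-assoc a b (coeff r k) ⟨
  a *ℤ b *ℤ coeff r k                    ≡⟨ coeff-scale (a *ℤ b) r k ⟨
  coeff (map ((a *ℤ b) *ℤ_) r) k         ∎
  where open ≡-Reasoning

≋0ᴾ⇒*ᴾ≋0ᴾ : ∀ p r → p ≋ 0ᴾ → p *ᴾ r ≋ 0ᴾ
≋0ᴾ⇒*ᴾ≋0ᴾ []      r _       = ≋-refl
≋0ᴾ⇒*ᴾ≋0ᴾ (a ∷ p) r (mk≋ h) = ≋-trans (+ᴾ-cong a·r≋0 (qᴾ*-cong p·r≋0)) (mk≋ λ { zero → refl ; (suc k) → refl })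
  where
  a·r≋0 : map (a *ℤ_) r ≋ 0ᴾ
  a·r≋0 = ≋-trans (mk≋ λ k → cong (λ b → coeff (map (b *ℤ_) r) k) (h 0)) (scale-zero r)
  p·r≋0 : p *ᴾ r ≋ 0ᴾ
  p·r≋0 = ≋0ᴾ⇒*ᴾ≋0ᴾ p r (mk≋ λ k → h (suc k))

*ᴾ-congʳ : ∀ {p p′} r → p ≋ p′ → p *ᴾ r ≋ p′ *ᴾ r
*ᴾ-congʳ {[]}    {p′}     r h       = ≋-sym (≋0ᴾ⇒*ᴾ≋0ᴾ p′ r (≋-sym h))
*ᴾ-congʳ {a ∷ p} {[]}     r h       = ≋0ᴾ⇒*ᴾ≋0ᴾ (a ∷ p) r h
*ᴾ-congʳ {a ∷ p} {b ∷ p′} r (mk≋ h) =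
  +ᴾ-cong (mk≋ λ k → cong (λ c → coeff (map (c *ℤ_) r) k) (h 0))
          (qᴾ*-cong (*ᴾ-congʳ {p} {p′} r (mk≋ λ k → h (suc k))))

*ᴾ-distribʳ-+ᴾ : ∀ r p p′ → (p +ᴾ p′) *ᴾ r ≋ p *ᴾ r +ᴾ p′ *ᴾ r
*ᴾ-distribʳ-+ᴾ r []      p′       = ≋-refl
*ᴾ-distribʳ-+ᴾ r (a ∷ p) []       = ≋-sym (+ᴾ-identityʳ _)
*ᴾ-distribʳ-+ᴾ r (a ∷ p) (b ∷ p′) = begin
  map ((a +ℤ b) *ℤ_) r +ᴾ qᴾ* ((p +ᴾ p′) *ᴾ r)
    ≈⟨ +ᴾ-cong a+b·r (≋-trans (qᴾ*-cong (*ᴾ-distribʳ-+ᴾ r p p′)) (qᴾ*-distrib-+ᴾ (p *ᴾ r) (p′ *ᴾ r))) ⟩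
  (map (a *ℤ_) r +ᴾ map (b *ℤ_) r) +ᴾ (qᴾ* (p *ᴾ r) +ᴾ qᴾ* (p′ *ᴾ r))
    ≈⟨ +ᴾ-interchange (map (a *ℤ_) r) (map (b *ℤ_) r) (qᴾ* (p *ᴾ r)) (qᴾ* (p′ *ᴾ r)) ⟩
  (map (a *ℤ_) r +ᴾ qᴾ* (p *ᴾ r)) +ᴾ (map (b *ℤ_) r +ᴾ qᴾ* (p′ *ᴾ r)) ∎
  where
  open ≋-Reasoning
  a+b·r : map ((a +ℤ b) *ℤ_) r ≋ map (a *ℤ_) r +ᴾ map (b *ℤ_) r
  a+b·r = mk≋ λ k → trans (coeff-scale (a +ℤ b) r k) (trans (ℤₚ.*-distribʳ-+ (coeff r k) a b)
            (sym (trans (coeff-+ᴾ (map (a *ℤ_) r) _ k) (cong₂ _+ℤ_ (coeff-scale a r k) (coeff-scale b r k)))))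

scale-*ᴾ : ∀ a p r → map (a *ℤ_) (p *ᴾ r) ≋ map (a *ℤ_) p *ᴾ r
scale-*ᴾ a []      r = ≋-refl
scale-*ᴾ a (b ∷ p) r = begin
  map (a *ℤ_) (map (b *ℤ_) r +ᴾ qᴾ* (p *ᴾ r))
    ≈⟨ scale-distrib-+ᴾ a (map (b *ℤ_) r) (qᴾ* (p *ᴾ r)) ⟩
  map (a *ℤ_) (map (b *ℤ_) r) +ᴾ map (a *ℤ_) (qᴾ* (p *ᴾ r))
    ≈⟨ +ᴾ-cong (scale-scale a b r) (≋-trans (scale-qᴾ* a (p *ᴾ r)) (qᴾ*-cong (scale-*ᴾ a p r))) ⟩
  map ((a *ℤ b) *ℤ_) r +ᴾ qᴾ* (map (a *ℤ_) p *ᴾ r) ∎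
  where open ≋-Reasoning

qᴾ*-*ᴾ : ∀ p r → qᴾ* p *ᴾ r ≋ qᴾ* (p *ᴾ r)
qᴾ*-*ᴾ p r = +ᴾ-cong (scale-zero r) ≋-refl

*ᴾ-identityˡ : ∀ r → 1ᴾ *ᴾ r ≋ r
*ᴾ-identityˡ r = ≋-trans (+ᴾ-cong (scale-one r) (mk≋ λ { zero → refl ; (suc k) → refl })) (+ᴾ-identityʳ r)

*ᴾ-zeroʳ : ∀ r → r *ᴾ 0ᴾ ≋ 0ᴾ
*ᴾ-zeroʳ []      = ≋-refl
*ᴾ-zeroʳ (a ∷ r) = mk≋ λ { zero → refl ; (suc k) → coeff-≡ (*ᴾ-zeroʳ r) k }

*ᴾ-consʳ : ∀ r a p → r *ᴾ (a ∷ p) ≋ map (a *ℤ_) r +ᴾ qᴾ* (r *ᴾ p)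
*ᴾ-consʳ []      a p = mk≋ λ { zero → refl ; (suc k) → refl }
*ᴾ-consʳ (b ∷ r) a p = mk≋ λ
  { zero    → cong (_+ℤ 0ℤ) (ℤₚ.*-comm b a)
  ; (suc k) → coeff-≡ tail-≋ k }
  where
  tail-≋ : map (b *ℤ_) p +ᴾ r *ᴾ (a ∷ p) ≋ map (a *ℤ_) r +ᴾ (map (b *ℤ_) p +ᴾ qᴾ* (r *ᴾ p))
  tail-≋ = ≋-trans (+ᴾ-cong ≋-refl (*ᴾ-consʳ r a p)) (+ᴾ-leftComm (map (b *ℤ_) p) (map (a *ℤ_) r) (qᴾ* (r *ᴾ p)))

*ᴾ-comm : ∀ p r → p *ᴾ r ≋ r *ᴾ p
*ᴾ-comm []      r = ≋-sym (*ᴾ-zeroʳ r)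
*ᴾ-comm (a ∷ p) r = ≋-trans (+ᴾ-cong ≋-refl (qᴾ*-cong (*ᴾ-comm p r))) (≋-sym (*ᴾ-consʳ r a p))

*ᴾ-congˡ : ∀ p {r r′} → r ≋ r′ → p *ᴾ r ≋ p *ᴾ r′
*ᴾ-congˡ p {r} {r′} h = ≋-trans (*ᴾ-comm p r) (≋-trans (*ᴾ-congʳ p h) (*ᴾ-comm r′ p))

*ᴾ-cong : ∀ {p p′ r r′} → p ≋ p′ → r ≋ r′ → p *ᴾ r ≋ p′ *ᴾ r′
*ᴾ-cong {p′ = p′} {r} h g = ≋-trans (*ᴾ-congʳ r h) (*ᴾ-congˡ p′ g)

*ᴾ-distribˡ-+ᴾ : ∀ p r r′ → p *ᴾ (r +ᴾ r′) ≋ p *ᴾ r +ᴾ p *ᴾ r′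
*ᴾ-distribˡ-+ᴾ p r r′ = ≋-trans (*ᴾ-comm p (r +ᴾ r′))
  (≋-trans (*ᴾ-distribʳ-+ᴾ p r r′) (+ᴾ-cong (*ᴾ-comm r p) (*ᴾ-comm r′ p)))

*ᴾ-assoc : ∀ p r s → (p *ᴾ r) *ᴾ s ≋ p *ᴾ (r *ᴾ s)
*ᴾ-assoc []      r s = ≋-refl
*ᴾ-assoc (a ∷ p) r s = ≋-trans (*ᴾ-distribʳ-+ᴾ s (map (a *ℤ_) r) (qᴾ* (p *ᴾ r)))
  (+ᴾ-cong (≋-sym (scale-*ᴾ a r s)) (≋-trans (qᴾ*-*ᴾ (p *ᴾ r) s) (qᴾ*-cong (*ᴾ-assoc p r s))))

+ᴾ-*ᴾ-commutativeRing : CommutativeRing _ _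
+ᴾ-*ᴾ-commutativeRing = record
  { Carrier = Poly ; _≈_ = _≋_ ; _+_ = _+ᴾ_ ; _*_ = _*ᴾ_ ; -_ = -ᴾ_ ; 0# = 0ᴾ ; 1# = 1ᴾ
  ; isCommutativeRing = record
    { isRing = record
      { +-isAbelianGroup = record
        { isGroup = record
          { isMonoid = record
            { isSemigroup = record
              { isMagma = record { isEquivalence = ≋-isEquivalence ; ∙-cong = +ᴾ-cong }
              ; assoc = +ᴾ-assoc }
            ; identity = (λ _ → ≋-refl) , +ᴾ-identityʳ }
          ; inverse = (λ p → ≋-trans (+ᴾ-comm (-ᴾ p) p) (+ᴾ-inverseʳ p)) , +ᴾ-inverseʳ
          ; ⁻¹-cong = -ᴾ-cong }
        ; comm = +ᴾ-comm }
      ; *-cong = *ᴾ-cong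
      ; *-assoc = *ᴾ-assoc
      ; *-identity = *ᴾ-identityˡ , (λ r → ≋-trans (*ᴾ-comm r 1ᴾ) (*ᴾ-identityˡ r))
      ; distrib = *ᴾ-distribˡ-+ᴾ , *ᴾ-distribʳ-+ᴾ }
    ; *-comm = *ᴾ-comm } }

constᴾ : ℤ → Poly
constᴾ a = a ∷ []

constᴾ-morphism : ℤ.+-*-rawRing ACR.-Raw-AlmostCommutative⟶ ACR.fromCommutativeRing +ᴾ-*ᴾ-commutativeRing
constᴾ-morphism = record
  { ⟦_⟧    = constᴾ
  ; +-homo = λ _ _ → ≋-refl
  ; *-homo = λ _ _ → mk≋ λ { zero → sym (ℤₚ.+-identityʳ _) ; (suc zero) → refl ; (suc (suc k)) → refl }
  ; -‿homo = λ _ → ≋-refl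
  ; 0-homo = mk≋ λ { zero → refl ; (suc k) → refl }
  ; 1-homo = ≋-refl }

constᴾ-≟ : ∀ a b → Maybe (constᴾ a ≋ constᴾ b)
constᴾ-≟ a b with a ℤₚ.≟ b
... | yes a≡b = just (mk≋ λ { zero → a≡b ; (suc k) → refl })
... | no _    = nothing

open import Algebra.Solver.Ring ℤ.+-*-rawRing (ACR.fromCommutativeRing +ᴾ-*ᴾ-commutativeRing) constᴾ-morphism constᴾ-≟
  using (solve; _:=_; _:+_; _:*_; _:-_; :-_; con)

qᴾ : Poly
qᴾ = 0ℤ ∷ 1ℤ ∷ []

qᴾ*≋qᴾ-*ᴾ : ∀ p → qᴾ* p ≋ qᴾ *ᴾ p
qᴾ*≋qᴾ-*ᴾ p = ≋-sym (≋-trans (+ᴾ-cong (scale-zero p) (qᴾ*-cong (*ᴾ-identityˡ p))) ≋-refl)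

coeff-qᴾ-*ᴾ-zero : ∀ p → coeff (qᴾ *ᴾ p) 0 ≡ 0ℤ
coeff-qᴾ-*ᴾ-zero p = sym (coeff-≡ (qᴾ*≋qᴾ-*ᴾ p) 0)

coeff-qᴾ-*ᴾ-suc : ∀ p k → coeff (qᴾ *ᴾ p) (suc k) ≡ coeff p k
coeff-qᴾ-*ᴾ-suc p k = sym (coeff-≡ (qᴾ*≋qᴾ-*ᴾ p) (suc k))

coeff-*ᴾ-zero : ∀ p r → coeff (p *ᴾ r) 0 ≡ coeff p 0 *ℤ coeff r 0
coeff-*ᴾ-zero []      r = sym (ℤₚ.*-zeroˡ (coeff r 0))
coeff-*ᴾ-zero (a ∷ p) r = trans (coeff-+ᴾ (map (a *ℤ_) r) (qᴾ* (p *ᴾ r)) 0)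
  (trans (ℤₚ.+-identityʳ _) (coeff-scale a r 0))

coeff-*ᴾ-zero-monic : ∀ p r → coeff p 0 ≡ 1ℤ → coeff (p *ᴾ r) 0 ≡ coeff r 0
coeff-*ᴾ-zero-monic p r p₀≡1 =
  trans (coeff-*ᴾ-zero p r) (trans (cong (_*ℤ coeff r 0) p₀≡1) (ℤₚ.*-identityˡ (coeff r 0)))

1≢0 : 1ℤ ≢ 0ℤ
1≢0 ()

0≤i*j : ∀ {i j} → 0ℤ ℤ.≤ i → 0ℤ ℤ.≤ j → 0ℤ ℤ.≤ i *ℤ j
0≤i*j {ℤ.+ m} {ℤ.+ n} (ℤ.+≤+ _) (ℤ.+≤+ _) = subst (0ℤ ℤ.≤_) (ℤₚ.pos-* m n) (ℤ.+≤+ z≤n)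

0<i*j : ∀ {i j} → 0ℤ ℤ.< i → 0ℤ ℤ.< j → 0ℤ ℤ.< i *ℤ j
0<i*j {ℤ.+ suc m} {ℤ.+ suc n} (ℤ.+<+ _) (ℤ.+<+ _) = subst (0ℤ ℤ.<_) (ℤₚ.pos-* (suc m) (suc n)) (ℤ.+<+ (s≤s z≤n))

NonNegative : Poly → Set
NonNegative p = ∀ k → 0ℤ ℤ.≤ coeff p k

VanishesAbove : Poly → ℕ → Set
VanishesAbove p d = ∀ k → d < k → coeff p k ≡ 0ℤ

record PositiveBetween (p : Poly) (lo hi : ℕ) : Set where
  field
    nonNegative : NonNegative p
    positive    : ∀ k → lo ≤ k → k ≤ hi → 0ℤ ℤ.< coeff p k
    vanishes    : VanishesAbove p hi
open PositiveBetween

nonNegative-+ᴾ : ∀ p r → NonNegative p → NonNegative r → NonNegative (p +ᴾ r)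
nonNegative-+ᴾ p r p≥0 r≥0 k = subst (0ℤ ℤ.≤_) (sym (coeff-+ᴾ p r k)) (ℤₚ.+-mono-≤ (p≥0 k) (r≥0 k))

nonNegative-qᴾ-*ᴾ : ∀ p → NonNegative p → NonNegative (qᴾ *ᴾ p)
nonNegative-qᴾ-*ᴾ p p≥0 zero    = subst (0ℤ ℤ.≤_) (sym (coeff-qᴾ-*ᴾ-zero p)) ℤₚ.≤-refl
nonNegative-qᴾ-*ᴾ p p≥0 (suc k) = subst (0ℤ ℤ.≤_) (sym (coeff-qᴾ-*ᴾ-suc p k)) (p≥0 k)

nonNegative-qᴾ* : ∀ p → NonNegative p → NonNegative (qᴾ* p)
nonNegative-qᴾ* p p≥0 zero    = ℤₚ.≤-refl
nonNegative-qᴾ* p p≥0 (suc k) = p≥0 k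

nonNegative-*ᴾ : ∀ p r → NonNegative p → NonNegative r → NonNegative (p *ᴾ r)
nonNegative-*ᴾ []      r p≥0 r≥0 k = ℤₚ.≤-refl
nonNegative-*ᴾ (a ∷ p) r p≥0 r≥0 =
  nonNegative-+ᴾ (map (a *ℤ_) r) (qᴾ* (p *ᴾ r))
    (λ k → subst (0ℤ ℤ.≤_) (sym (coeff-scale a r k)) (0≤i*j (p≥0 0) (r≥0 k)))
    (nonNegative-qᴾ* (p *ᴾ r) (nonNegative-*ᴾ p r (λ k → p≥0 (suc k)) r≥0))

vanishesAbove-mono : ∀ {p d d′} → d ≤ d′ → VanishesAbove p d → VanishesAbove p d′
vanishesAbove-mono d≤d′ p≡0 k d′<k = p≡0 k (ℕₚ.≤-<-trans d≤d′ d′<k)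

vanishesAbove-*ᴾ : ∀ p r i j → VanishesAbove p i → VanishesAbove r j → VanishesAbove (p *ᴾ r) (i + j)
vanishesAbove-*ᴾ []      r i j p≡0 r≡0 k _     = refl
vanishesAbove-*ᴾ (a ∷ p) r i j p≡0 r≡0 k i+j<k = begin
  coeff (map (a *ℤ_) r +ᴾ qᴾ* (p *ᴾ r)) k          ≡⟨ coeff-+ᴾ (map (a *ℤ_) r) (qᴾ* (p *ᴾ r)) k ⟩
  coeff (map (a *ℤ_) r) k +ℤ coeff (qᴾ* (p *ᴾ r)) k ≡⟨ cong₂ _+ℤ_ a·r≡0 (tail≡0 i k p≡0 i+j<k) ⟩
  0ℤ                                                ∎
  where
  open ≡-Reasoning
  a·r≡0 : coeff (map (a *ℤ_) r) k ≡ 0ℤ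
  a·r≡0 = trans (coeff-scale a r k)
            (trans (cong (a *ℤ_) (r≡0 k (ℕₚ.≤-<-trans (ℕₚ.m≤n+m j i) i+j<k))) (ℤₚ.*-zeroʳ a))
  tail≡0 : ∀ i k → VanishesAbove (a ∷ p) i → i + j < k → coeff (qᴾ* (p *ᴾ r)) k ≡ 0ℤ
  tail≡0 i       zero    _   ()
  tail≡0 zero    (suc k) p≡0 _ = coeff-≡ (≋0ᴾ⇒*ᴾ≋0ᴾ p r (mk≋ λ k → p≡0 (suc k) (s≤s z≤n))) k
  tail≡0 (suc i) (suc k) p≡0 (s≤s i+j<k) =
    vanishesAbove-*ᴾ p r i j (λ k i<k → p≡0 (suc k) (s≤s i<k)) r≡0 k i+j<k

coeff-*ᴾ-top : ∀ p r i j → VanishesAbove p i → VanishesAbove r j →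
               coeff (p *ᴾ r) (i + j) ≡ coeff p i *ℤ coeff r j
coeff-*ᴾ-top []      r i       j p≡0 r≡0 = sym (ℤₚ.*-zeroˡ (coeff r j))
coeff-*ᴾ-top (a ∷ p) r zero    j p≡0 r≡0 = begin
  coeff (map (a *ℤ_) r +ᴾ qᴾ* (p *ᴾ r)) j            ≡⟨ coeff-+ᴾ (map (a *ℤ_) r) (qᴾ* (p *ᴾ r)) j ⟩
  coeff (map (a *ℤ_) r) j +ℤ coeff (qᴾ* (p *ᴾ r)) j  ≡⟨ cong₂ _+ℤ_ (coeff-scale a r j) (tail≡0 j) ⟩
  a *ℤ coeff r j +ℤ 0ℤ                               ≡⟨ ℤₚ.+-identityʳ _ ⟩
  a *ℤ coeff r j                                     ∎
  where
  open ≡-Reasoning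
  tail≡0 : ∀ j → coeff (qᴾ* (p *ᴾ r)) j ≡ 0ℤ
  tail≡0 zero    = refl
  tail≡0 (suc j) = coeff-≡ (≋0ᴾ⇒*ᴾ≋0ᴾ p r (mk≋ λ k → p≡0 (suc k) (s≤s z≤n))) j
coeff-*ᴾ-top (a ∷ p) r (suc i) j p≡0 r≡0 = begin
  coeff (map (a *ℤ_) r +ᴾ qᴾ* (p *ᴾ r)) (suc (i + j))  ≡⟨ coeff-+ᴾ (map (a *ℤ_) r) (qᴾ* (p *ᴾ r)) (suc (i + j)) ⟩
  coeff (map (a *ℤ_) r) (suc (i + j)) +ℤ coeff (p *ᴾ r) (i + j)
    ≡⟨ cong₂ _+ℤ_ a·r≡0 (coeff-*ᴾ-top p r i j (λ k i<k → p≡0 (suc k) (s≤s i<k)) r≡0) ⟩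
  0ℤ +ℤ coeff p i *ℤ coeff r j                        ≡⟨ ℤₚ.+-identityˡ _ ⟩
  coeff p i *ℤ coeff r j                              ∎
  where
  open ≡-Reasoning
  a·r≡0 : coeff (map (a *ℤ_) r) (suc (i + j)) ≡ 0ℤ
  a·r≡0 = trans (coeff-scale a r (suc (i + j)))
            (trans (cong (a *ℤ_) (r≡0 (suc (i + j)) (s≤s (ℕₚ.m≤n+m j i)))) (ℤₚ.*-zeroʳ a))

x≤x+nonNeg : ∀ {x y} → 0ℤ ℤ.≤ y → x ℤ.≤ x +ℤ y
x≤x+nonNeg {x} 0≤y = subst (ℤ._≤ x +ℤ _) (ℤₚ.+-identityʳ x) (ℤₚ.+-monoʳ-≤ x 0≤y)

x≤nonNeg+x : ∀ {x y} → 0ℤ ℤ.≤ y → x ℤ.≤ y +ℤ x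
x≤nonNeg+x {x} {y} 0≤y = subst (x ℤ.≤_) (ℤₚ.+-comm x y) (x≤x+nonNeg 0≤y)

coeff-*ᴾ-≥ : ∀ p r → NonNegative p → NonNegative r →
             ∀ i j → coeff p i *ℤ coeff r j ℤ.≤ coeff (p *ᴾ r) (i + j)
coeff-*ᴾ-≥ []      r p≥0 r≥0 i       j = ℤₚ.≤-reflexive (ℤₚ.*-zeroˡ (coeff r j))
coeff-*ᴾ-≥ (a ∷ p) r p≥0 r≥0 zero    j = begin
  a *ℤ coeff r j                                       ≡⟨ coeff-scale a r j ⟨
  coeff (map (a *ℤ_) r) j                              ≤⟨ x≤x+nonNeg (nonNegative-qᴾ* (p *ᴾ r) p·r≥0 j) ⟩
  coeff (map (a *ℤ_) r) j +ℤ coeff (qᴾ* (p *ᴾ r)) j    ≡⟨ coeff-+ᴾ (map (a *ℤ_) r) (qᴾ* (p *ᴾ r)) j ⟨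
  coeff ((a ∷ p) *ᴾ r) j                               ∎
  where
  open ℤₚ.≤-Reasoning
  p·r≥0 = nonNegative-*ᴾ p r (λ k → p≥0 (suc k)) r≥0
coeff-*ᴾ-≥ (a ∷ p) r p≥0 r≥0 (suc i) j = begin
  coeff p i *ℤ coeff r j                               ≤⟨ coeff-*ᴾ-≥ p r (λ k → p≥0 (suc k)) r≥0 i j ⟩
  coeff (p *ᴾ r) (i + j)                               ≤⟨ x≤nonNeg+x a·r≥0 ⟩
  coeff (map (a *ℤ_) r) (suc (i + j)) +ℤ coeff (p *ᴾ r) (i + j)
                                                       ≡⟨ coeff-+ᴾ (map (a *ℤ_) r) (qᴾ* (p *ᴾ r)) (suc (i + j)) ⟨
  coeff ((a ∷ p) *ᴾ r) (suc (i + j))                   ∎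
  where
  open ℤₚ.≤-Reasoning
  a·r≥0 = subst (0ℤ ℤ.≤_) (sym (coeff-scale a r (suc (i + j)))) (0≤i*j (p≥0 0) (r≥0 (suc (i + j))))

split-range : ∀ {l₁ h₁ l₂ h₂ k} → l₁ ≤ h₁ → l₂ ≤ h₂ → l₁ + l₂ ≤ k → k ≤ h₁ + h₂ →
  Σ ℕ λ i → Σ ℕ λ j → i + j ≡ k × (l₁ ≤ i × i ≤ h₁) × (l₂ ≤ j × j ≤ h₂)
split-range {l₁} {h₁} {l₂} {h₂} {k} l₁≤h₁ l₂≤h₂ lo hi with k ℕₚ.≤? h₁ + l₂
... | yes k≤h₁+l₂ =
  k ∸ l₂ , l₂ , ℕₚ.m∸n+n≡m (ℕₚ.m+n≤o⇒n≤o l₁ lo) ,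
  (ℕₚ.m+n≤o⇒m≤o∸n l₁ lo , ℕₚ.m≤n+o⇒m∸n≤o k l₂ (subst (k ≤_) (ℕₚ.+-comm h₁ l₂) k≤h₁+l₂)) ,
  (ℕₚ.≤-refl , l₂≤h₂)
... | no k≰h₁+l₂ =
  h₁ , k ∸ h₁ , ℕₚ.m+[n∸m]≡n (ℕₚ.m+n≤o⇒m≤o h₁ h₁+l₂≤k) ,
  (l₁≤h₁ , ℕₚ.≤-refl) ,
  (ℕₚ.m+n≤o⇒m≤o∸n l₂ (subst (_≤ k) (ℕₚ.+-comm h₁ l₂) h₁+l₂≤k) , ℕₚ.m≤n+o⇒m∸n≤o k h₁ hi)
  where
  h₁+l₂≤k : h₁ + l₂ ≤ k
  h₁+l₂≤k = ℕₚ.<⇒≤ (ℕₚ.≰⇒> k≰h₁+l₂)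

positiveBetween-*ᴾ : ∀ {p r l₁ h₁ l₂ h₂} → l₁ ≤ h₁ → l₂ ≤ h₂ →
  PositiveBetween p l₁ h₁ → PositiveBetween r l₂ h₂ → PositiveBetween (p *ᴾ r) (l₁ + l₂) (h₁ + h₂)
positiveBetween-*ᴾ {p} {r} {l₁} {h₁} {l₂} {h₂} l₁≤h₁ l₂≤h₂ P R = record
  { nonNegative = nonNegative-*ᴾ p r (nonNegative P) (nonNegative R)
  ; positive    = p·r>0
  ; vanishes    = vanishesAbove-*ᴾ p r h₁ h₂ (vanishes P) (vanishes R) }
  where
  p·r>0 : ∀ k → l₁ + l₂ ≤ k → k ≤ h₁ + h₂ → 0ℤ ℤ.< coeff (p *ᴾ r) k
  p·r>0 k lo hi with split-range l₁≤h₁ l₂≤h₂ lo hi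
  ... | i , j , refl , (l₁≤i , i≤h₁) , (l₂≤j , j≤h₂) =
    ℤₚ.<-≤-trans (0<i*j (positive P i l₁≤i i≤h₁) (positive R j l₂≤j j≤h₂))
                 (coeff-*ᴾ-≥ p r (nonNegative P) (nonNegative R) i j)

positiveBetween-qᴾ-*ᴾ : ∀ {p lo hi} → PositiveBetween p lo hi → PositiveBetween (qᴾ *ᴾ p) (suc lo) (suc hi)
positiveBetween-qᴾ-*ᴾ {p} P = record
  { nonNegative = nonNegative-qᴾ-*ᴾ p (nonNegative P)
  ; positive    = λ { zero () _ ; (suc k) (s≤s lo≤k) (s≤s k≤hi) →
                      subst (0ℤ ℤ.<_) (sym (coeff-qᴾ-*ᴾ-suc p k)) (positive P k lo≤k k≤hi) }
  ; vanishes    = λ { zero () ; (suc k) (s≤s hi<k) → trans (coeff-qᴾ-*ᴾ-suc p k) (vanishes P k hi<k) } }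

positiveBetween-+ᴾ : ∀ {p r l₁ h₁ l₂ h₂} → PositiveBetween p l₁ h₁ → PositiveBetween r l₂ h₂ →
  l₂ ≤ l₁ → l₁ ≤ suc h₂ → h₂ ≤ h₁ → PositiveBetween (p +ᴾ r) l₂ h₁
positiveBetween-+ᴾ {p} {r} {l₁} {h₁} {l₂} {h₂} P R l₂≤l₁ l₁≤1+h₂ h₂≤h₁ = record
  { nonNegative = nonNegative-+ᴾ p r (nonNegative P) (nonNegative R)
  ; positive    = λ k lo hi → subst (0ℤ ℤ.<_) (sym (coeff-+ᴾ p r k)) (p+r>0 k lo hi)
  ; vanishes    = λ k h₁<k → trans (coeff-+ᴾ p r k)
                    (cong₂ _+ℤ_ (vanishes P k h₁<k) (vanishes R k (ℕₚ.≤-<-trans h₂≤h₁ h₁<k))) }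
  where
  p+r>0 : ∀ k → l₂ ≤ k → k ≤ h₁ → 0ℤ ℤ.< coeff p k +ℤ coeff r k
  p+r>0 k l₂≤k k≤h₁ with k ℕₚ.≤? h₂
  ... | yes k≤h₂ = ℤₚ.+-mono-≤-< (nonNegative P k) (positive R k l₂≤k k≤h₂)
  ... | no  k≰h₂ = ℤₚ.+-mono-<-≤ (positive P k (ℕₚ.≤-trans l₁≤1+h₂ (ℕₚ.≰⇒> k≰h₂)) k≤h₁) (nonNegative R k)

record MonicPositiveUpTo (p : Poly) (d : ℕ) : Set where
  field
    positiveBetween : PositiveBetween p 0 d
    top             : coeff p d ≡ 1ℤ
    bottom          : coeff p 0 ≡ 1ℤ

monicPositive-qᴾ-*ᴾ-+ᴾ : ∀ {p r l h g} → PositiveBetween p l h → coeff p h ≡ 1ℤ →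
  PositiveBetween r 0 g → coeff r 0 ≡ 1ℤ → l ≤ g → g ≤ h → MonicPositiveUpTo (qᴾ *ᴾ p +ᴾ r) (suc h)
monicPositive-qᴾ-*ᴾ-+ᴾ {p} {r} {l} {h} {g} P p-top R r-bottom l≤g g≤h = record
  { positiveBetween = positiveBetween-+ᴾ (positiveBetween-qᴾ-*ᴾ P) R z≤n (s≤s l≤g) (ℕₚ.m≤n⇒m≤1+n g≤h)
  ; top    = trans (coeff-+ᴾ (qᴾ *ᴾ p) r (suc h))
               (cong₂ _+ℤ_ (trans (coeff-qᴾ-*ᴾ-suc p h) p-top) (vanishes R (suc h) (s≤s g≤h)))
  ; bottom = trans (coeff-+ᴾ (qᴾ *ᴾ p) r 0) (cong₂ _+ℤ_ (coeff-qᴾ-*ᴾ-zero p) r-bottom) }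

-- r (q) = qⁿ p (q⁻¹)
record Reversal (n : ℕ) (p r : Poly) : Set where
  field
    reverses  : ∀ k → k ≤ n → coeff r k ≡ coeff p (n ∸ k)
    vanishesˡ : VanishesAbove p n
    vanishesʳ : VanishesAbove r n
open Reversal

reversal-sym : ∀ {n p r} → Reversal n p r → Reversal n r p
reversal-sym {n} {p} {r} R = record
  { reverses  = λ k k≤n → sym (trans (reverses R (n ∸ k) (ℕₚ.m∸n≤m n k)) (cong (coeff p) (ℕₚ.m∸[m∸n]≡n k≤n)))
  ; vanishesˡ = vanishesʳ R
  ; vanishesʳ = vanishesˡ R }

reversal-qᴾ-*ᴾˡ : ∀ {n p r} → Reversal n p r → Reversal (suc n) (qᴾ *ᴾ p) r
reversal-qᴾ-*ᴾˡ {n} {p} {r} R = record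
  { reverses  = reverses′
  ; vanishesˡ = λ { zero () ; (suc k) (s≤s n<k) → trans (coeff-qᴾ-*ᴾ-suc p k) (vanishesˡ R k n<k) }
  ; vanishesʳ = vanishesAbove-mono {r} (ℕₚ.n≤1+n n) (vanishesʳ R) }
  where
  reverses′ : ∀ k → k ≤ suc n → coeff r k ≡ coeff (qᴾ *ᴾ p) (suc n ∸ k)
  reverses′ k k≤1+n with ℕₚ.m≤n⇒m<n∨m≡n k≤1+n
  ... | inj₁ (s≤s k≤n) = begin
    coeff r k                        ≡⟨ reverses R k k≤n ⟩
    coeff p (n ∸ k)                  ≡⟨ coeff-qᴾ-*ᴾ-suc p (n ∸ k) ⟨
    coeff (qᴾ *ᴾ p) (suc (n ∸ k))    ≡⟨ cong (coeff (qᴾ *ᴾ p)) (ℕₚ.+-∸-assoc 1 k≤n) ⟨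
    coeff (qᴾ *ᴾ p) (suc n ∸ k)      ∎
    where open ≡-Reasoning
  ... | inj₂ refl = begin
    coeff r (suc n)                  ≡⟨ vanishesʳ R (suc n) ℕₚ.≤-refl ⟩
    0ℤ                               ≡⟨ coeff-qᴾ-*ᴾ-zero p ⟨
    coeff (qᴾ *ᴾ p) 0                ≡⟨ cong (coeff (qᴾ *ᴾ p)) (ℕₚ.n∸n≡0 (suc n)) ⟨
    coeff (qᴾ *ᴾ p) (suc n ∸ suc n)  ∎
    where open ≡-Reasoning

reversal-qᴾ-*ᴾʳ : ∀ {n p r} → Reversal n p r → Reversal (suc n) p (qᴾ *ᴾ r)
reversal-qᴾ-*ᴾʳ R = reversal-sym (reversal-qᴾ-*ᴾˡ (reversal-sym R))

reversal-qᴾ-*ᴾ : ∀ {n p r} → Reversal n p r → Reversal (suc (suc n)) (qᴾ *ᴾ p) (qᴾ *ᴾ r)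
reversal-qᴾ-*ᴾ R = reversal-qᴾ-*ᴾʳ (reversal-qᴾ-*ᴾˡ R)

reversal-+ᴾ : ∀ {n p r p′ r′} → Reversal n p r → Reversal n p′ r′ → Reversal n (p +ᴾ p′) (r +ᴾ r′)
reversal-+ᴾ {n} {p} {r} {p′} {r′} R R′ = record
  { reverses  = λ k k≤n → trans (coeff-+ᴾ r r′ k)
                  (trans (cong₂ _+ℤ_ (reverses R k k≤n) (reverses R′ k k≤n)) (sym (coeff-+ᴾ p p′ (n ∸ k))))
  ; vanishesˡ = λ k n<k → trans (coeff-+ᴾ p p′ k) (cong₂ _+ℤ_ (vanishesˡ R k n<k) (vanishesˡ R′ k n<k))
  ; vanishesʳ = λ k n<k → trans (coeff-+ᴾ r r′ k) (cong₂ _+ℤ_ (vanishesʳ R k n<k) (vanishesʳ R′ k n<k)) }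

reversal-negᴾ : ∀ {n p r} → Reversal n p r → Reversal n (-ᴾ p) (-ᴾ r)
reversal-negᴾ {n} {p} {r} R = record
  { reverses  = λ k k≤n → trans (coeff-negᴾ r k) (trans (cong -ℤ_ (reverses R k k≤n)) (sym (coeff-negᴾ p (n ∸ k))))
  ; vanishesˡ = λ k n<k → trans (coeff-negᴾ p k) (cong -ℤ_ (vanishesˡ R k n<k))
  ; vanishesʳ = λ k n<k → trans (coeff-negᴾ r k) (cong -ℤ_ (vanishesʳ R k n<k)) }

reversal-resp-≋ : ∀ {n p r p′ r′} → p ≋ p′ → r ≋ r′ → Reversal n p r → Reversal n p′ r′
reversal-resp-≋ {n} (mk≋ p≈p′) (mk≋ r≈r′) R = record
  { reverses  = λ k k≤n → trans (sym (r≈r′ k)) (trans (reverses R k k≤n) (p≈p′ (n ∸ k)))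
  ; vanishesˡ = λ k n<k → trans (sym (p≈p′ k)) (vanishesˡ R k n<k)
  ; vanishesʳ = λ k n<k → trans (sym (r≈r′ k)) (vanishesʳ R k n<k) }

-- The subtractive Euclidean algorithm on q-rationals

T L : RatFun → RatFun
T (N , D) = (qᴾ *ᴾ N +ᴾ D , D)
L (N , D) = (qᴾ *ᴾ N , qᴾ *ᴾ N +ᴾ D)

-- Reduced forms of ([p/d]_q , [d/p]_q).
State : Set
State = RatFun × RatFun

step : State → State
step (x , y) = (T x , L y)

base : State
base = ((1ᴾ , 1ᴾ) , (1ᴾ , 1ᴾ))

euclid : ℕ → ℕ → ℕ → State
euclid zero    p d = base
euclid (suc f) p d with ℕₚ.<-cmp p d
... | tri< _ _ _ = swap (step (euclid f (d ∸ p) p))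
... | tri≈ _ _ _ = base
... | tri> _ _ _ = step (euclid f (p ∸ d) d)

qPair : ℕ → ℕ → State
qPair p d = euclid (suc (p + d)) p d

reduced : ℕ → ℕ → RatFun
reduced p d = proj₁ (qPair p d)

euclid-induction : (P : State → Set) → P base → (∀ {s} → P s → P (step s)) → (∀ {s} → P s → P (swap s)) →
                   ∀ f p d → P (euclid f p d)
euclid-induction P P-base P-step P-swap zero    p d = P-base
euclid-induction P P-base P-step P-swap (suc f) p d with ℕₚ.<-cmp p d
... | tri< _ _ _ = P-swap (P-step (euclid-induction P P-base P-step P-swap f (d ∸ p) p))
... | tri≈ _ _ _ = P-base
... | tri> _ _ _ = P-step (euclid-induction P P-base P-step P-swap f (p ∸ d) d)

qPair-induction : (P : State → Set) → P base → (∀ {s} → P s → P (step s)) → (∀ {s} → P s → P (swap s)) →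
                  ∀ p d → P (qPair p d)
qPair-induction P P-base P-step P-swap p d = euclid-induction P P-base P-step P-swap (suc (p + d)) p d

n∸m+m<g : ∀ {m n g} → 1 ≤ m → m ≤ n → m + n ≤ g → (n ∸ m) + m < g
n∸m+m<g {m} {n} 1≤m m≤n m+n≤g = subst (_< _) (sym (ℕₚ.m∸n+n≡m m≤n)) (ℕₚ.<-≤-trans (ℕₚ.m<n+m n 1≤m) m+n≤g)

euclid-fuel : ∀ f f′ p d → 1 ≤ p → 1 ≤ d → p + d < f → p + d < f′ → euclid f p d ≡ euclid f′ p d
euclid-fuel (suc f) (suc f′) p d 1≤p 1≤d (s≤s p+d≤f) (s≤s p+d≤f′) with ℕₚ.<-cmp p d
... | tri< p<d _ _ = cong (swap ∘ step) (euclid-fuel f f′ (d ∸ p) p (ℕₚ.m<n⇒0<n∸m p<d) 1≤p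
                       (n∸m+m<g 1≤p (ℕₚ.<⇒≤ p<d) p+d≤f) (n∸m+m<g 1≤p (ℕₚ.<⇒≤ p<d) p+d≤f′))
... | tri≈ _ _ _   = refl
... | tri> _ _ d<p = cong step (euclid-fuel f f′ (p ∸ d) d (ℕₚ.m<n⇒0<n∸m d<p) 1≤d
                       (n∸m+m<g 1≤d (ℕₚ.<⇒≤ d<p) (subst (_≤ f) (ℕₚ.+-comm p d) p+d≤f))
                       (n∸m+m<g 1≤d (ℕₚ.<⇒≤ d<p) (subst (_≤ f′) (ℕₚ.+-comm p d) p+d≤f′)))

qPair-< : ∀ {p d} → 1 ≤ p → p < d → qPair p d ≡ swap (step (qPair (d ∸ p) p))
qPair-< {p} {d} 1≤p p<d with ℕₚ.<-cmp p d
... | tri< _ _ _   = cong (swap ∘ step) (euclid-fuel (p + d) (suc (d ∸ p + p)) (d ∸ p) p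
                       (ℕₚ.m<n⇒0<n∸m p<d) 1≤p (n∸m+m<g 1≤p (ℕₚ.<⇒≤ p<d) ℕₚ.≤-refl) ℕₚ.≤-refl)
... | tri≈ _ p≡d _ = ⊥-elim (ℕₚ.<-irrefl p≡d p<d)
... | tri> _ _ d<p = ⊥-elim (ℕₚ.<-asym p<d d<p)

qPair-> : ∀ {p d} → 1 ≤ d → d < p → qPair p d ≡ step (qPair (p ∸ d) d)
qPair-> {p} {d} 1≤d d<p with ℕₚ.<-cmp p d
... | tri< p<d _ _ = ⊥-elim (ℕₚ.<-asym p<d d<p)
... | tri≈ _ p≡d _ = ⊥-elim (ℕₚ.<-irrefl (sym p≡d) d<p)
... | tri> _ _ _   = cong step (euclid-fuel (p + d) (suc (p ∸ d + d)) (p ∸ d) d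
                       (ℕₚ.m<n⇒0<n∸m d<p) 1≤d (n∸m+m<g 1≤d (ℕₚ.<⇒≤ d<p) (ℕₚ.≤-reflexive (ℕₚ.+-comm d p))) ℕₚ.≤-refl)

qPair-≡ : ∀ p → qPair p p ≡ base
qPair-≡ p with ℕₚ.<-cmp p p
... | tri< p<p _ _ = ⊥-elim (ℕₚ.<-irrefl refl p<p)
... | tri≈ _ _ _   = refl
... | tri> _ _ p<p = ⊥-elim (ℕₚ.<-irrefl refl p<p)

qPair-swap : ∀ {p d} → 1 ≤ p → 1 ≤ d → qPair d p ≡ swap (qPair p d)
qPair-swap {p} {d} 1≤p 1≤d = by-cases (ℕₚ.<-cmp p d)
  where
  by-cases : Tri (p < d) (p ≡ d) (d < p) → qPair d p ≡ swap (qPair p d)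
  by-cases (tri< p<d _ _)  = trans (qPair-> 1≤p p<d) (cong swap (sym (qPair-< 1≤p p<d)))
  by-cases (tri≈ _ refl _) = trans (qPair-≡ p) (cong swap (sym (qPair-≡ p)))
  by-cases (tri> _ _ d<p)  = trans (qPair-< 1≤d d<p) (cong swap (sym (qPair-> 1≤d d<p)))

reduced-swap : ∀ {p d} → 1 ≤ p → 1 ≤ d → proj₂ (qPair p d) ≡ reduced d p
reduced-swap 1≤p 1≤d = cong proj₁ (sym (qPair-swap 1≤p 1≤d))

reduced-> : ∀ {p d} → 1 ≤ d → d < p → reduced p d ≡ T (reduced (p ∸ d) d)
reduced-> 1≤d d<p = cong proj₁ (qPair-> 1≤d d<p)

reduced-< : ∀ {p d} → 1 ≤ p → p < d → reduced p d ≡ L (reduced p (d ∸ p))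
reduced-< 1≤p p<d = trans (cong proj₁ (qPair-< 1≤p p<d)) (cong L (reduced-swap (ℕₚ.m<n⇒0<n∸m p<d) 1≤p))

m<[1+j]*m+n : ∀ j m {n} → 1 ≤ n → m < suc j * m + n
m<[1+j]*m+n j m 1≤n = ℕₚ.<-≤-trans (ℕₚ.m<m+n m 1≤n) (ℕₚ.+-monoˡ-≤ _ (ℕₚ.m≤m+n m (j * m)))

[1+j]*m+n∸m≡j*m+n : ∀ j m n → suc j * m + n ∸ m ≡ j * m + n
[1+j]*m+n∸m≡j*m+n j m n = trans (cong (_∸ m) (ℕₚ.+-assoc m (j * m) n)) (ℕₚ.m+n∸m≡n m (j * m + n))

reduced-iterate-T : ∀ j {d r} → 1 ≤ d → 1 ≤ r → reduced (j * d + r) d ≡ iter j T (reduced r d)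
reduced-iterate-T zero    1≤d 1≤r = refl
reduced-iterate-T (suc j) {d} {r} 1≤d 1≤r = begin
  reduced (suc j * d + r) d               ≡⟨ reduced-> 1≤d (m<[1+j]*m+n j d 1≤r) ⟩
  T (reduced (suc j * d + r ∸ d) d)       ≡⟨ cong (λ p → T (reduced p d)) ([1+j]*m+n∸m≡j*m+n j d r) ⟩
  T (reduced (j * d + r) d)               ≡⟨ cong T (reduced-iterate-T j 1≤d 1≤r) ⟩
  T (iter j T (reduced r d))              ∎
  where open ≡-Reasoning

reduced-iterate-L : ∀ j {r t} → 1 ≤ r → 1 ≤ t → reduced r (j * r + t) ≡ iter j L (reduced r t)
reduced-iterate-L zero    1≤r 1≤t = refl
reduced-iterate-L (suc j) {r} {t} 1≤r 1≤t = begin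
  reduced r (suc j * r + t)               ≡⟨ reduced-< 1≤r (m<[1+j]*m+n j r 1≤t) ⟩
  L (reduced r (suc j * r + t ∸ r))       ≡⟨ cong (λ d → L (reduced r d)) ([1+j]*m+n∸m≡j*m+n j r t) ⟩
  L (reduced r (j * r + t))               ≡⟨ cong L (reduced-iterate-L j 1≤r 1≤t) ⟩
  L (iter j L (reduced r t))              ∎
  where open ≡-Reasoning

infix 8 qᴾ^_
qᴾ^_ : ℕ → Poly
qᴾ^ zero  = 1ᴾ
qᴾ^ suc k = qᴾ *ᴾ qᴾ^ k

record Bezout (x : RatFun) : Set where
  field
    a c      : Poly
    k        : ℕ
    identity : a *ᴾ proj₂ x -ᴾ c *ᴾ proj₁ x ≋ qᴾ^ k

bezout-T : ∀ {x} → Bezout x → Bezout (T x)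
bezout-T {N , D} record { a = a ; c = c ; k = k ; identity = aD-cN≋qᵏ } = record
  { a = qᴾ *ᴾ a +ᴾ c ; c = c ; k = suc k
  ; identity = ≋-trans
      (solve 5 (λ q a c N D → (q :* a :+ c) :* D :- c :* (q :* N :+ D) := q :* (a :* D :- c :* N)) ≋-refl qᴾ a c N D)
      (*ᴾ-congˡ qᴾ aD-cN≋qᵏ) }

bezout-L : ∀ {x} → Bezout x → Bezout (L x)
bezout-L {N , D} record { a = a ; c = c ; k = k ; identity = aD-cN≋qᵏ } = record
  { a = qᴾ *ᴾ a ; c = qᴾ *ᴾ a +ᴾ c ; k = suc k
  ; identity = ≋-trans
      (solve 5 (λ q a c N D → (q :* a) :* (q :* N :+ D) :- (q :* a :+ c) :* (q :* N)
                              := q :* (a :* D :- c :* N)) ≋-refl qᴾ a c N D)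
      (*ᴾ-congˡ qᴾ aD-cN≋qᵏ) }

bezout-1 : Bezout (1ᴾ , 1ᴾ)
bezout-1 = record { a = 1ᴾ ; c = 0ᴾ ; k = 0 ; identity = mk≋ λ { zero → refl ; (suc k) → refl } }

bezout-reduced : ∀ p d → Bezout (reduced p d)
bezout-reduced p d = proj₁ (qPair-induction (λ s → Bezout (proj₁ s) × Bezout (proj₂ s))
  (bezout-1 , bezout-1) (λ (b , b̄) → bezout-T b , bezout-L b̄) swap p d)

positiveBetween-1ᴾ : PositiveBetween 1ᴾ 0 0
positiveBetween-1ᴾ = record
  { nonNegative = λ { zero → ℤ.+≤+ z≤n ; (suc k) → ℤₚ.≤-refl }
  ; positive    = λ { zero _ _ → ℤ.+<+ (s≤s z≤n) ; (suc k) _ () }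
  ; vanishes    = λ { zero () ; (suc k) _ → refl } }

reversal-1ᴾ*ᴾ1ᴾ : Reversal 0 (1ᴾ *ᴾ 1ᴾ) (1ᴾ *ᴾ 1ᴾ)
reversal-1ᴾ*ᴾ1ᴾ = reversal-resp-≋ (≋-sym (*ᴾ-identityˡ 1ᴾ)) (≋-sym (*ᴾ-identityˡ 1ᴾ)) (record
  { reverses  = λ { zero _ → refl }
  ; vanishesˡ = λ { zero () ; (suc k) _ → refl }
  ; vanishesʳ = λ { zero () ; (suc k) _ → refl } })

reversal-step-NN̄ : ∀ {n N D N̄ D̄} → Reversal n (N *ᴾ N̄) (D *ᴾ D̄) → Reversal n (D *ᴾ N̄) (D *ᴾ N̄) →
  Reversal (suc (suc n)) ((qᴾ *ᴾ N +ᴾ D) *ᴾ (qᴾ *ᴾ N̄)) (D *ᴾ (qᴾ *ᴾ N̄ +ᴾ D̄))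
reversal-step-NN̄ {N = N} {D} {N̄} {D̄} NN̄↔DD̄ DN̄↔DN̄ = reversal-resp-≋
  (solve 5 (λ q N D N̄ D̄ → q :* (q :* (N :* N̄)) :+ q :* (D :* N̄) := (q :* N :+ D) :* (q :* N̄)) ≋-refl qᴾ N D N̄ D̄)
  (solve 5 (λ q N D N̄ D̄ → D :* D̄ :+ q :* (D :* N̄) := D :* (q :* N̄ :+ D̄)) ≋-refl qᴾ N D N̄ D̄)
  (reversal-+ᴾ (reversal-qᴾ-*ᴾˡ (reversal-qᴾ-*ᴾˡ NN̄↔DD̄)) (reversal-qᴾ-*ᴾ DN̄↔DN̄))

reversal-step-ND̄ : ∀ {n N D N̄ D̄} → Reversal n (N *ᴾ N̄) (D *ᴾ D̄) →
  Reversal n (N *ᴾ D̄) (N *ᴾ D̄) → Reversal n (D *ᴾ N̄) (D *ᴾ N̄) →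
  Reversal (suc (suc n)) ((qᴾ *ᴾ N +ᴾ D) *ᴾ (qᴾ *ᴾ N̄ +ᴾ D̄)) ((qᴾ *ᴾ N +ᴾ D) *ᴾ (qᴾ *ᴾ N̄ +ᴾ D̄))
reversal-step-ND̄ {N = N} {D} {N̄} {D̄} NN̄↔DD̄ ND̄↔ND̄ DN̄↔DN̄ = reversal-resp-≋
  (solve 5 (λ q N D N̄ D̄ → (q :* (q :* (N :* N̄)) :+ q :* (N :* D̄)) :+ (q :* (D :* N̄) :+ D :* D̄)
                          := (q :* N :+ D) :* (q :* N̄ :+ D̄)) ≋-refl qᴾ N D N̄ D̄)
  (solve 5 (λ q N D N̄ D̄ → (D :* D̄ :+ q :* (N :* D̄)) :+ (q :* (D :* N̄) :+ q :* (q :* (N :* N̄)))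
                          := (q :* N :+ D) :* (q :* N̄ :+ D̄)) ≋-refl qᴾ N D N̄ D̄)
  (reversal-+ᴾ (reversal-+ᴾ q²NN̄↔DD̄ (reversal-qᴾ-*ᴾ ND̄↔ND̄))
               (reversal-+ᴾ (reversal-qᴾ-*ᴾ DN̄↔DN̄) (reversal-sym q²NN̄↔DD̄)))
  where
  q²NN̄↔DD̄ : Reversal (suc (suc _)) (qᴾ *ᴾ (qᴾ *ᴾ (N *ᴾ N̄))) (D *ᴾ D̄)
  q²NN̄↔DD̄ = reversal-qᴾ-*ᴾˡ (reversal-qᴾ-*ᴾˡ NN̄↔DD̄)

record Shape (N D N̄ D̄ : Poly) : Set where
  field
    e ℓ ℓ̄           : ℕ
    ℓ+ℓ̄≤e           : ℓ + ℓ̄ ≤ e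
    N-positive      : PositiveBetween N ℓ e
    N-top           : coeff N e ≡ 1ℤ
    D-positive      : PositiveBetween D 0 (e ∸ ℓ̄)
    D-bottom        : coeff D 0 ≡ 1ℤ
    N̄-positive      : PositiveBetween N̄ ℓ̄ e
    N̄-top           : coeff N̄ e ≡ 1ℤ
    D̄-positive      : PositiveBetween D̄ 0 (e ∸ ℓ)
    D̄-bottom        : coeff D̄ 0 ≡ 1ℤ
    NN̄-reversal-DD̄  : Reversal (e + e) (N *ᴾ N̄) (D *ᴾ D̄)
    ND̄-palindromic  : Reversal (e + e) (N *ᴾ D̄) (N *ᴾ D̄)
    DN̄-palindromic  : Reversal (e + e) (D *ᴾ N̄) (D *ᴾ N̄)

  ℓ≤e : ℓ ≤ e
  ℓ≤e = ℕₚ.m+n≤o⇒m≤o ℓ ℓ+ℓ̄≤e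

  ℓ̄≤e : ℓ̄ ≤ e
  ℓ̄≤e = ℕₚ.m+n≤o⇒n≤o ℓ ℓ+ℓ̄≤e

  ℓ≤e∸ℓ̄ : ℓ ≤ e ∸ ℓ̄
  ℓ≤e∸ℓ̄ = ℕₚ.m+n≤o⇒m≤o∸n ℓ ℓ+ℓ̄≤e

  ℓ̄≤e∸ℓ : ℓ̄ ≤ e ∸ ℓ
  ℓ̄≤e∸ℓ = ℕₚ.m+n≤o⇒m≤o∸n ℓ̄ (subst (_≤ e) (ℕₚ.+-comm ℓ ℓ̄) ℓ+ℓ̄≤e)

ShapeOf : State → Set
ShapeOf ((N , D) , (N̄ , D̄)) = Shape N D N̄ D̄

shape-base : ShapeOf base
shape-base = record
  { e = 0 ; ℓ = 0 ; ℓ̄ = 0 ; ℓ+ℓ̄≤e = z≤n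
  ; N-positive = positiveBetween-1ᴾ ; N-top = refl ; D-positive = positiveBetween-1ᴾ ; D-bottom = refl
  ; N̄-positive = positiveBetween-1ᴾ ; N̄-top = refl ; D̄-positive = positiveBetween-1ᴾ ; D̄-bottom = refl
  ; NN̄-reversal-DD̄ = reversal-1ᴾ*ᴾ1ᴾ ; ND̄-palindromic = reversal-1ᴾ*ᴾ1ᴾ ; DN̄-palindromic = reversal-1ᴾ*ᴾ1ᴾ }

shape-swap : ∀ {s} → ShapeOf s → ShapeOf (swap s)
shape-swap {(N , D) , (N̄ , D̄)} sh = record
  { e = e ; ℓ = ℓ̄ ; ℓ̄ = ℓ ; ℓ+ℓ̄≤e = subst (_≤ e) (ℕₚ.+-comm ℓ ℓ̄) ℓ+ℓ̄≤e
  ; N-positive = N̄-positive ; N-top = N̄-top ; D-positive = D̄-positive ; D-bottom = D̄-bottom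
  ; N̄-positive = N-positive ; N̄-top = N-top ; D̄-positive = D-positive ; D̄-bottom = D-bottom
  ; NN̄-reversal-DD̄ = reversal-resp-≋ (*ᴾ-comm N N̄) (*ᴾ-comm D D̄) NN̄-reversal-DD̄
  ; ND̄-palindromic = reversal-resp-≋ (*ᴾ-comm D N̄) (*ᴾ-comm D N̄) DN̄-palindromic
  ; DN̄-palindromic = reversal-resp-≋ (*ᴾ-comm N D̄) (*ᴾ-comm N D̄) ND̄-palindromic }
  where open Shape sh

shape-step : ∀ {s} → ShapeOf s → ShapeOf (step s)
shape-step {(N , D) , (N̄ , D̄)} sh = record
  { e = suc e ; ℓ = 0 ; ℓ̄ = suc ℓ̄ ; ℓ+ℓ̄≤e = s≤s ℓ̄≤e
  ; N-positive = MonicPositiveUpTo.positiveBetween qN+D ; N-top = MonicPositiveUpTo.top qN+D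
  ; D-positive = D-positive ; D-bottom = D-bottom
  ; N̄-positive = positiveBetween-qᴾ-*ᴾ N̄-positive ; N̄-top = trans (coeff-qᴾ-*ᴾ-suc N̄ e) N̄-top
  ; D̄-positive = MonicPositiveUpTo.positiveBetween qN̄+D̄ ; D̄-bottom = MonicPositiveUpTo.bottom qN̄+D̄
  ; NN̄-reversal-DD̄ = subst-degree (reversal-step-NN̄ {N = N} {D} {N̄} {D̄} NN̄-reversal-DD̄ DN̄-palindromic)
  ; ND̄-palindromic = subst-degree
      (reversal-step-ND̄ {N = N} {D} {N̄} {D̄} NN̄-reversal-DD̄ ND̄-palindromic DN̄-palindromic)
  ; DN̄-palindromic = subst-degree (reversal-resp-≋ q[DN̄]≋D[qN̄] q[DN̄]≋D[qN̄] (reversal-qᴾ-*ᴾ DN̄-palindromic)) }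
  where
  open Shape sh
  qN+D : MonicPositiveUpTo (qᴾ *ᴾ N +ᴾ D) (suc e)
  qN+D = monicPositive-qᴾ-*ᴾ-+ᴾ N-positive N-top D-positive D-bottom ℓ≤e∸ℓ̄ (ℕₚ.m∸n≤m e ℓ̄)
  qN̄+D̄ : MonicPositiveUpTo (qᴾ *ᴾ N̄ +ᴾ D̄) (suc e)
  qN̄+D̄ = monicPositive-qᴾ-*ᴾ-+ᴾ N̄-positive N̄-top D̄-positive D̄-bottom ℓ̄≤e∸ℓ (ℕₚ.m∸n≤m e ℓ)
  q[DN̄]≋D[qN̄] : qᴾ *ᴾ (D *ᴾ N̄) ≋ D *ᴾ (qᴾ *ᴾ N̄)
  q[DN̄]≋D[qN̄] = solve 3 (λ q D N̄ → q :* (D :* N̄) := D :* (q :* N̄)) ≋-refl qᴾ D N̄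
  subst-degree : ∀ {p r} → Reversal (suc (suc (e + e))) p r → Reversal (suc e + suc e) p r
  subst-degree {p} {r} = subst (λ n → Reversal n p r) (cong suc (sym (ℕₚ.+-suc e e)))

shape-qPair : ∀ p d → ShapeOf (qPair p d)
shape-qPair = qPair-induction ShapeOf shape-base shape-step shape-swap

-- The literal computation qrat agrees with the reduced fractions

infix 4 _≋₂_
record _≋₂_ (x y : RatFun) : Set where
  constructor _,≋_
  field
    numerator≋   : proj₁ x ≋ proj₁ y
    denominator≋ : proj₂ x ≋ proj₂ y

≋₂-refl : ∀ {x} → x ≋₂ x
≋₂-refl = ≋-refl ,≋ ≋-refl

≋₂-sym : ∀ {x y} → x ≋₂ y → y ≋₂ x
≋₂-sym (n≋ ,≋ d≋) = ≋-sym n≋ ,≋ ≋-sym d≋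

≋₂-trans : ∀ {x y z} → x ≋₂ y → y ≋₂ z → x ≋₂ z
≋₂-trans (n≋ ,≋ d≋) (n≋′ ,≋ d≋′) = ≋-trans n≋ n≋′ ,≋ ≋-trans d≋ d≋′

≡⇒≋₂ : ∀ {x y} → x ≡ y → x ≋₂ y
≡⇒≋₂ refl = ≋₂-refl

≋₂-setoid : Setoid _ _
≋₂-setoid = record { _≈_ = _≋₂_ ; isEquivalence = record { refl = ≋₂-refl ; sym = ≋₂-sym ; trans = ≋₂-trans } }

module ≋₂-Reasoning = Relation.Binary.Reasoning.Setoid ≋₂-setoid

infixr 7 _·_
_·_ : Poly → RatFun → RatFun
c · (N , D) = (c *ᴾ N , c *ᴾ D)

·-congˡ : ∀ c {x y} → x ≋₂ y → c · x ≋₂ c · y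
·-congˡ c (n≋ ,≋ d≋) = *ᴾ-congˡ c n≋ ,≋ *ᴾ-congˡ c d≋

·-identityˡ : ∀ x → 1ᴾ · x ≋₂ x
·-identityˡ (N , D) = *ᴾ-identityˡ N ,≋ *ᴾ-identityˡ D

·-assoc : ∀ c c′ x → c · c′ · x ≋₂ (c *ᴾ c′) · x
·-assoc c c′ (N , D) = ≋-sym (*ᴾ-assoc c c′ N) ,≋ ≋-sym (*ᴾ-assoc c c′ D)

-qᴾ : Poly
-qᴾ = -ᴾ qᴾ

infix 8 -qᴾ^_
-qᴾ^_ : ℕ → Poly
-qᴾ^ zero  = 1ᴾ
-qᴾ^ suc a = -qᴾ^ a *ᴾ -qᴾ

-- Sq and Tq⁻¹, with qᴾ* written as multiplication by qᴾ so that the ring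
-- solver applies; T and Tq are related in the same way.
S T⁻¹ : RatFun → RatFun
S   (P , Q) = (-ᴾ Q , qᴾ *ᴾ P)
T⁻¹ (P , Q) = (P -ᴾ Q , qᴾ *ᴾ Q)

Tq-≋₂ : ∀ {x y} → x ≋₂ y → Tq x ≋₂ T y
Tq-≋₂ {P , Q} {P′ , Q′} (P≋ ,≋ Q≋) = +ᴾ-cong (≋-trans (qᴾ*-cong P≋) (qᴾ*≋qᴾ-*ᴾ P′)) Q≋ ,≋ Q≋

Tq⁻¹-≋₂ : ∀ {x y} → x ≋₂ y → Tq⁻¹ x ≋₂ T⁻¹ y
Tq⁻¹-≋₂ {P , Q} {P′ , Q′} (P≋ ,≋ Q≋) = +ᴾ-cong P≋ (-ᴾ-cong Q≋) ,≋ ≋-trans (qᴾ*-cong Q≋) (qᴾ*≋qᴾ-*ᴾ Q′)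

Sq-≋₂ : ∀ {x y} → x ≋₂ y → Sq x ≋₂ S y
Sq-≋₂ {P , Q} {P′ , Q′} (P≋ ,≋ Q≋) = -ᴾ-cong Q≋ ,≋ ≋-trans (qᴾ*-cong P≋) (qᴾ*≋qᴾ-*ᴾ P′)

T-cong : ∀ {x y} → x ≋₂ y → T x ≋₂ T y
T-cong (N≋ ,≋ D≋) = +ᴾ-cong (*ᴾ-congˡ qᴾ N≋) D≋ ,≋ D≋

L-cong : ∀ {x y} → x ≋₂ y → L x ≋₂ L y
L-cong (N≋ ,≋ D≋) = *ᴾ-congˡ qᴾ N≋ ,≋ +ᴾ-cong (*ᴾ-congˡ qᴾ N≋) D≋

S-cong : ∀ {x y} → x ≋₂ y → S x ≋₂ S y
S-cong (P≋ ,≋ Q≋) = -ᴾ-cong Q≋ ,≋ *ᴾ-congˡ qᴾ P≋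

T⁻¹-cong : ∀ {x y} → x ≋₂ y → T⁻¹ x ≋₂ T⁻¹ y
T⁻¹-cong (P≋ ,≋ Q≋) = +ᴾ-cong P≋ (-ᴾ-cong Q≋) ,≋ *ᴾ-congˡ qᴾ Q≋

T-· : ∀ c x → T (c · x) ≋₂ c · T x
T-· c (N , D) = solve 4 (λ q c N D → q :* (c :* N) :+ c :* D := c :* (q :* N :+ D)) ≋-refl qᴾ c N D ,≋ ≋-refl

L-· : ∀ c x → L (c · x) ≋₂ c · L x
L-· c (N , D) = solve 3 (λ q c N → q :* (c :* N) := c :* (q :* N)) ≋-refl qᴾ c N
             ,≋ solve 4 (λ q c N D → q :* (c :* N) :+ c :* D := c :* (q :* N :+ D)) ≋-refl qᴾ c N D

S-· : ∀ c x → S (c · x) ≋₂ c · S x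
S-· c (P , Q) = solve 2 (λ c Q → :- (c :* Q) := c :* (:- Q)) ≋-refl c Q
             ,≋ solve 3 (λ q c P → q :* (c :* P) := c :* (q :* P)) ≋-refl qᴾ c P

T⁻¹-· : ∀ c x → T⁻¹ (c · x) ≋₂ c · T⁻¹ x
T⁻¹-· c (P , Q) = solve 3 (λ c P Q → c :* P :- c :* Q := c :* (P :- Q)) ≋-refl c P Q
               ,≋ solve 3 (λ q c Q → q :* (c :* Q) := c :* (q :* Q)) ≋-refl qᴾ c Q

iterate-resp : ∀ (f g : RatFun → RatFun) → (∀ {x y} → x ≋₂ y → f x ≋₂ g y) →
               ∀ j {x y} → x ≋₂ y → iter j f x ≋₂ iter j g y
iterate-resp f g f≋g zero    x≋y = x≋y
iterate-resp f g f≋g (suc j) x≋y = f≋g (iterate-resp f g f≋g j x≋y)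

iterate-· : ∀ (f : RatFun → RatFun) → (∀ {x y} → x ≋₂ y → f x ≋₂ f y) → (∀ c x → f (c · x) ≋₂ c · f x) →
            ∀ j c x → iter j f (c · x) ≋₂ c · iter j f x
iterate-· f f-cong f-· zero    c x = ≋₂-refl
iterate-· f f-cong f-· (suc j) c x = ≋₂-trans (f-cong (iterate-· f f-cong f-· j c x)) (f-· c (iter j f x))

S∘T⁻¹≋L∘S : ∀ w → S (T⁻¹ w) ≋₂ L (S w)
S∘T⁻¹≋L∘S (P , Q) = solve 2 (λ q Q → :- (q :* Q) := q :* (:- Q)) ≋-refl qᴾ Q
                 ,≋ solve 3 (λ q P Q → q :* (P :- Q) := q :* (:- Q) :+ q :* P) ≋-refl qᴾ P Q

S∘T⁻¹∘L : ∀ v → S (T⁻¹ (L v)) ≋₂ -qᴾ · T v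
S∘T⁻¹∘L (N , D) = solve 3 (λ q N D → :- (q :* (q :* N :+ D)) := (:- q) :* (q :* N :+ D)) ≋-refl qᴾ N D
               ,≋ solve 3 (λ q N D → q :* (q :* N :- (q :* N :+ D)) := (:- q) :* D) ≋-refl qᴾ N D

S∘T⁻¹-0 : S (T⁻¹ (0ᴾ , 1ᴾ)) ≋₂ -qᴾ · (1ᴾ , 1ᴾ)
S∘T⁻¹-0 = solve 1 (λ q → :- (q :* con 1ℤ) := (:- q) :* con 1ℤ) ≋-refl qᴾ
       ,≋ solve 1 (λ q → q :* (con 0ℤ :- con 1ℤ) := (:- q) :* con 1ℤ) ≋-refl qᴾ

S∘T⁻¹ᵏ⁺¹ : ∀ k w → S (iter (suc k) T⁻¹ w) ≋₂ iter k L (S (T⁻¹ w))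
S∘T⁻¹ᵏ⁺¹ zero    w = ≋₂-refl
S∘T⁻¹ᵏ⁺¹ (suc k) w = ≋₂-trans (S∘T⁻¹≋L∘S (iter (suc k) T⁻¹ w)) (L-cong (S∘T⁻¹ᵏ⁺¹ k w))

reduced₀ : ℕ → ℕ → RatFun
reduced₀ zero    d = zeroRF
reduced₀ (suc p) d = reduced (suc p) d

reduced₀-suc : ∀ {p} d → 1 ≤ p → reduced₀ p d ≡ reduced p d
reduced₀-suc d (s≤s _) = refl

iterate-Tq-zeroRF : ∀ p → iter p Tq zeroRF ≋₂ reduced₀ p 1
iterate-Tq-zeroRF zero          = ≋₂-refl
iterate-Tq-zeroRF (suc zero)    = ≋₂-refl
iterate-Tq-zeroRF (suc (suc p)) = ≋₂-trans (Tq-≋₂ (iterate-Tq-zeroRF (suc p)))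
                                           (≡⇒≋₂ (sym (reduced-> {suc (suc p)} (s≤s z≤n) (s≤s (s≤s z≤n)))))

coprime-0 : ∀ {d} → Coprime 0 d → d ≡ 1
coprime-0 {d} 0⊥d = 0⊥d (d ∣0 , ∣-refl)

coprime-% : ∀ {p d} .{{_ : NonZero d}} → Coprime p d → Coprime (p % d) d
coprime-% p⊥d (i∣p%d , i∣d) = p⊥d (∣n∣m%n⇒∣m i∣d i∣p%d , i∣d)

coprime-complement : ∀ K {r d s} → d + s ≡ K * r → Coprime r d → Coprime s r
coprime-complement K {r} {d} {s} d+s≡Kr r⊥d {i} (i∣s , i∣r) =
  r⊥d (i∣r , ∣m+n∣m⇒∣n (subst (i ∣_) (trans (sym d+s≡Kr) (ℕₚ.+-comm d s)) (∣n⇒∣m*n K i∣r)) i∣s)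

-- (d + r′) / (1 + r′) is ⌈d / (1 + r′)⌉.
ceiling-bounds : ∀ d r′ → let K = (d + r′) / suc r′ in d ≤ K * suc r′ × K * suc r′ ∸ d < suc r′
ceiling-bounds d r′ = d≤Kr , Kr∸d<r
  where
  r = suc r′
  K = (d + r′) / r
  d+r′<r+Kr : d + r′ < r + K * r
  d+r′<r+Kr = subst (_< r + K * r) (sym (m≡m%n+[m/n]*n (d + r′) r)) (ℕₚ.+-monoˡ-< (K * r) (m%n<n (d + r′) r))
  d≤Kr : d ≤ K * r
  d≤Kr = ℕₚ.+-cancelʳ-≤ r′ d (K * r) (subst (d + r′ ≤_) (ℕₚ.+-comm r′ (K * r)) (ℕₚ.≤-pred d+r′<r+Kr))
  Kr∸d<r : K * r ∸ d < r
  Kr∸d<r = ℕₚ.≤-<-trans (ℕₚ.∸-monoˡ-≤ d (m/n*n≤m (d + r′) r)) (subst (_< r) (sym (ℕₚ.m+n∸m≡n d r′)) ℕₚ.≤-refl)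

d+s≡[1+k]*r⇒d≡k*r+[r∸s] : ∀ k r {d s} → s ≤ r → d + s ≡ suc k * r → d ≡ k * r + (r ∸ s)
d+s≡[1+k]*r⇒d≡k*r+[r∸s] k r {d} {s} s≤r d+s≡ = begin
  d                   ≡⟨ ℕₚ.m+n∸n≡m d s ⟨
  d + s ∸ s           ≡⟨ cong (_∸ s) (trans d+s≡ (ℕₚ.+-comm r (k * r))) ⟩
  k * r + r ∸ s       ≡⟨ ℕₚ.+-∸-assoc (k * r) s≤r ⟩
  k * r + (r ∸ s)     ∎
  where open ≡-Reasoning

ceiling-decomposition : ∀ K₀ {r d s} → 1 ≤ r → s < r → d + s ≡ suc K₀ * r → Coprime s r →
  Σ RatFun λ y → S (T⁻¹ (reduced₀ s r)) ≋₂ -qᴾ · y × reduced r d ≡ iter K₀ L y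
ceiling-decomposition K₀ {r} {d} {zero} 1≤r _ d+0≡ 0⊥r with coprime-0 0⊥r
... | refl = (1ᴾ , 1ᴾ) , S∘T⁻¹-0 , (begin
  reduced 1 d              ≡⟨ cong (reduced 1) (d+s≡[1+k]*r⇒d≡k*r+[r∸s] K₀ 1 z≤n d+0≡) ⟩
  reduced 1 (K₀ * 1 + 1)   ≡⟨ reduced-iterate-L K₀ (s≤s z≤n) (s≤s z≤n) ⟩
  iter K₀ L (1ᴾ , 1ᴾ)      ∎)
  where open ≡-Reasoning
ceiling-decomposition K₀ {r} {d} {suc s′} 1≤r s<r d+s≡ _ = T V , S∘T⁻¹[s/r] , [r/d]≡
  where
  open ≡-Reasoning
  s = suc s′
  t = r ∸ s
  V = reduced s t
  1≤t : 1 ≤ t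
  1≤t = ℕₚ.m<n⇒0<n∸m s<r
  t<r : t < r
  t<r = ℕₚ.∸-monoʳ-< (s≤s z≤n) (ℕₚ.<⇒≤ s<r)
  S∘T⁻¹[s/r] : S (T⁻¹ (reduced s r)) ≋₂ -qᴾ · T V
  S∘T⁻¹[s/r] = ≋₂-trans (≡⇒≋₂ (cong (S ∘ T⁻¹) (reduced-< (s≤s z≤n) s<r))) (S∘T⁻¹∘L V)
  [r/d]≡ : reduced r d ≡ iter K₀ L (T V)
  [r/d]≡ = begin
    reduced r d                       ≡⟨ cong (reduced r) (d+s≡[1+k]*r⇒d≡k*r+[r∸s] K₀ r (ℕₚ.<⇒≤ s<r) d+s≡) ⟩
    reduced r (K₀ * r + t)            ≡⟨ reduced-iterate-L K₀ 1≤r 1≤t ⟩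
    iter K₀ L (reduced r t)           ≡⟨ cong (iter K₀ L) (reduced-> 1≤t t<r) ⟩
    iter K₀ L (T (reduced (r ∸ t) t)) ≡⟨ cong (λ p → iter K₀ L (T (reduced p t))) (ℕₚ.m∸[m∸n]≡n (ℕₚ.<⇒≤ s<r)) ⟩
    iter K₀ L (T V)                   ∎

go-ceiling-step : ∀ K {r d} c {x} → 1 ≤ r → 1 ≤ d → d ≤ K * r → K * r ∸ d < r → Coprime r d →
  x ≋₂ c · reduced₀ (K * r ∸ d) r → Sq (iter K Tq⁻¹ x) ≋₂ (c *ᴾ -qᴾ) · reduced r d
go-ceiling-step zero     c _ (s≤s _) ()
go-ceiling-step (suc K₀) {r} {d} c {x} 1≤r 1≤d d≤Kr s<r r⊥d x≋
  with ceiling-decomposition K₀ 1≤r s<r (ℕₚ.m+[n∸m]≡n d≤Kr) (coprime-complement (suc K₀) (ℕₚ.m+[n∸m]≡n d≤Kr) r⊥d)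
... | y , S∘T⁻¹x₀≋ , [r/d]≡ = begin
  Sq (iter (suc K₀) Tq⁻¹ x)        ≈⟨ Sq-≋₂ (iterate-resp Tq⁻¹ T⁻¹ Tq⁻¹-≋₂ (suc K₀) x≋) ⟩
  S (iter (suc K₀) T⁻¹ (c · x₀))   ≈⟨ S-cong (iterate-· T⁻¹ T⁻¹-cong T⁻¹-· (suc K₀) c x₀) ⟩
  S (c · iter (suc K₀) T⁻¹ x₀)     ≈⟨ S-· c (iter (suc K₀) T⁻¹ x₀) ⟩
  c · S (iter (suc K₀) T⁻¹ x₀)     ≈⟨ ·-congˡ c (S∘T⁻¹ᵏ⁺¹ K₀ x₀) ⟩
  c · iter K₀ L (S (T⁻¹ x₀))       ≈⟨ ·-congˡ c (iterate-resp L L L-cong K₀ S∘T⁻¹x₀≋) ⟩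
  c · iter K₀ L (-qᴾ · y)          ≈⟨ ·-congˡ c (iterate-· L L-cong L-· K₀ -qᴾ y) ⟩
  c · -qᴾ · iter K₀ L y            ≈⟨ ·-assoc c -qᴾ (iter K₀ L y) ⟩
  (c *ᴾ -qᴾ) · iter K₀ L y         ≡⟨ cong ((c *ᴾ -qᴾ) ·_) [r/d]≡ ⟨
  (c *ᴾ -qᴾ) · reduced r d         ∎
  where
  open ≋₂-Reasoning
  x₀ = reduced₀ (suc K₀ * r ∸ d) r

go-reduced : ∀ f p d → 1 ≤ d → d < f → Coprime p d → Σ ℕ λ a → go f p d ≋₂ -qᴾ^ a · reduced₀ p d
go-reduced (suc f) p (suc d′) _ (s≤s d≤f) p⊥d with p % suc d′ in p%d≡
... | zero   = 0 , divisible d′ (p⊥d (m%n≡0⇒n∣m p (suc d′) p%d≡ , ∣-refl))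
  where
  divisible : ∀ d′ → suc d′ ≡ 1 → iter (p / suc d′) Tq zeroRF ≋₂ 1ᴾ · reduced₀ p (suc d′)
  divisible zero refl = ≋₂-trans (≡⇒≋₂ (cong (λ j → iter j Tq zeroRF) (n/1≡n p)))
                          (≋₂-trans (iterate-Tq-zeroRF p) (≋₂-sym (·-identityˡ (reduced₀ p 1))))
... | suc r′ = suc a , (begin
  iter j Tq (Sq (iter K Tq⁻¹ (go f s r)))  ≈⟨ iterate-resp Tq T Tq-≋₂ j [r/d]-step ⟩
  iter j T (-qᴾ^ suc a · reduced r d)      ≈⟨ iterate-· T T-cong T-· j (-qᴾ^ suc a) (reduced r d) ⟩
  -qᴾ^ suc a · iter j T (reduced r d)      ≡⟨ cong (-qᴾ^ suc a ·_) (reduced-iterate-T j (s≤s z≤n) (s≤s z≤n)) ⟨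
  -qᴾ^ suc a · reduced (j * d + r) d       ≡⟨ cong (λ p → -qᴾ^ suc a · reduced p d) p≡jd+r ⟨
  -qᴾ^ suc a · reduced p d                 ≡⟨ cong (-qᴾ^ suc a ·_) (reduced₀-suc d 1≤p) ⟨
  -qᴾ^ suc a · reduced₀ p d                ∎)
  where
  open ≋₂-Reasoning
  d = suc d′
  r = suc r′
  j = p / d
  K = (d + r′) / r
  s = K * r ∸ d
  r⊥d : Coprime r d
  r⊥d = subst (λ r → Coprime r d) p%d≡ (coprime-% p⊥d)
  p≡jd+r : p ≡ j * d + r
  p≡jd+r = trans (m≡m%n+[m/n]*n p d) (trans (cong (_+ j * d) p%d≡) (ℕₚ.+-comm r (j * d)))
  1≤p : 1 ≤ p
  1≤p = subst (1 ≤_) (sym p≡jd+r) (ℕₚ.≤-trans (s≤s z≤n) (ℕₚ.m≤n+m r (j * d)))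
  d≤Kr = proj₁ (ceiling-bounds d r′)
  s<r = proj₂ (ceiling-bounds d r′)
  IH = go-reduced f s r (s≤s z≤n) (ℕₚ.<-≤-trans (subst (_< d) p%d≡ (m%n<n p d)) d≤f)
                  (coprime-complement K (ℕₚ.m+[n∸m]≡n d≤Kr) r⊥d)
  a = proj₁ IH
  [r/d]-step : Sq (iter K Tq⁻¹ (go f s r)) ≋₂ -qᴾ^ suc a · reduced r d
  [r/d]-step = go-ceiling-step K (-qᴾ^ a) (s≤s z≤n) (s≤s z≤n) d≤Kr s<r r⊥d (proj₂ IH)

-- Uniqueness of reduced forms

qᴾ-*ᴾ-cancelˡ : ∀ F G → qᴾ *ᴾ F ≋ qᴾ *ᴾ G → F ≋ G
qᴾ-*ᴾ-cancelˡ F G (mk≋ qF≈qG) = mk≋ λ k →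
  trans (sym (coeff-qᴾ-*ᴾ-suc F k)) (trans (qF≈qG (suc k)) (coeff-qᴾ-*ᴾ-suc G k))

-qᴾ^-*ᴾ-cancelˡ : ∀ a F G → -qᴾ^ a *ᴾ F ≋ -qᴾ^ a *ᴾ G → F ≋ G
-qᴾ^-*ᴾ-cancelˡ zero    F G 1F≋1G = ≋-trans (≋-sym (*ᴾ-identityˡ F)) (≋-trans 1F≋1G (*ᴾ-identityˡ G))
-qᴾ^-*ᴾ-cancelˡ (suc a) F G cF≋cG = qᴾ-*ᴾ-cancelˡ F G (begin
  qᴾ *ᴾ F           ≈⟨ solve 2 (λ q F → q :* F := :- ((:- q) :* F)) ≋-refl qᴾ F ⟩
  -ᴾ (-qᴾ *ᴾ F)     ≈⟨ -ᴾ-cong -qF≋-qG ⟩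
  -ᴾ (-qᴾ *ᴾ G)     ≈⟨ solve 2 (λ q G → :- ((:- q) :* G) := q :* G) ≋-refl qᴾ G ⟩
  qᴾ *ᴾ G           ∎)
  where
  open ≋-Reasoning
  -qF≋-qG : -qᴾ *ᴾ F ≋ -qᴾ *ᴾ G
  -qF≋-qG = -qᴾ^-*ᴾ-cancelˡ a (-qᴾ *ᴾ F) (-qᴾ *ᴾ G)
    (≋-trans (≋-sym (*ᴾ-assoc (-qᴾ^ a) -qᴾ F)) (≋-trans cF≋cG (*ᴾ-assoc (-qᴾ^ a) -qᴾ G)))

tailᴾ : Poly → Poly
tailᴾ []      = []
tailᴾ (_ ∷ p) = p

coeff-0≡0⇒≋qᴾ-*ᴾ-tailᴾ : ∀ p → coeff p 0 ≡ 0ℤ → p ≋ qᴾ *ᴾ tailᴾ p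
coeff-0≡0⇒≋qᴾ-*ᴾ-tailᴾ []      _   = ≋-sym (*ᴾ-zeroʳ qᴾ)
coeff-0≡0⇒≋qᴾ-*ᴾ-tailᴾ (a ∷ p) a≡0 = ≋-trans (mk≋ λ { zero → a≡0 ; (suc k) → refl }) (qᴾ*≋qᴾ-*ᴾ p)

-- Since D (0) = 1, qᵏ divides E whenever it divides D E.
divide-qᴾ^ : ∀ k {N D N₁ D₁} E → coeff D 0 ≡ 1ℤ → qᴾ^ k *ᴾ N₁ ≋ N *ᴾ E → qᴾ^ k *ᴾ D₁ ≋ D *ᴾ E →
             Σ Poly λ E′ → N₁ ≋ N *ᴾ E′ × D₁ ≋ D *ᴾ E′
divide-qᴾ^ zero    {N₁ = N₁} {D₁} E D₀≡1 N₁≋NE D₁≋DE =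
  E , ≋-trans (≋-sym (*ᴾ-identityˡ N₁)) N₁≋NE , ≋-trans (≋-sym (*ᴾ-identityˡ D₁)) D₁≋DE
divide-qᴾ^ (suc k) {N} {D} {N₁} {D₁} E D₀≡1 qᵏ⁺¹N₁≋NE qᵏ⁺¹D₁≋DE =
  divide-qᴾ^ k {N} {D} (tailᴾ E) D₀≡1 (lower N₁ N qᵏ⁺¹N₁≋NE) (lower D₁ D qᵏ⁺¹D₁≋DE)
  where
  E₀≡0 : coeff E 0 ≡ 0ℤ
  E₀≡0 = begin
    coeff E 0                     ≡⟨ coeff-*ᴾ-zero-monic D E D₀≡1 ⟨
    coeff (D *ᴾ E) 0              ≡⟨ coeff-≡ qᵏ⁺¹D₁≋DE 0 ⟨
    coeff (qᴾ^ suc k *ᴾ D₁) 0     ≡⟨ coeff-≡ (*ᴾ-assoc qᴾ (qᴾ^ k) D₁) 0 ⟩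
    coeff (qᴾ *ᴾ (qᴾ^ k *ᴾ D₁)) 0 ≡⟨ coeff-qᴾ-*ᴾ-zero (qᴾ^ k *ᴾ D₁) ⟩
    0ℤ                            ∎
    where open ≡-Reasoning
  lower : ∀ M₁ M → qᴾ^ suc k *ᴾ M₁ ≋ M *ᴾ E → qᴾ^ k *ᴾ M₁ ≋ M *ᴾ tailᴾ E
  lower M₁ M qᵏ⁺¹M₁≋ME = qᴾ-*ᴾ-cancelˡ (qᴾ^ k *ᴾ M₁) (M *ᴾ tailᴾ E) (begin
    qᴾ *ᴾ (qᴾ^ k *ᴾ M₁)     ≈⟨ *ᴾ-assoc qᴾ (qᴾ^ k) M₁ ⟨
    qᴾ^ suc k *ᴾ M₁         ≈⟨ qᵏ⁺¹M₁≋ME ⟩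
    M *ᴾ E                  ≈⟨ *ᴾ-congˡ M (coeff-0≡0⇒≋qᴾ-*ᴾ-tailᴾ E E₀≡0) ⟩
    M *ᴾ (qᴾ *ᴾ tailᴾ E)    ≈⟨ solve 3 (λ q M E → M :* (q :* E) := q :* (M :* E)) ≋-refl qᴾ M (tailᴾ E) ⟩
    qᴾ *ᴾ (M *ᴾ tailᴾ E)    ∎)
    where open ≋-Reasoning

≋0ᴾ⊎degree : ∀ p → p ≋ 0ᴾ ⊎ Σ ℕ λ d → coeff p d ≢ 0ℤ × VanishesAbove p d
≋0ᴾ⊎degree []      = inj₁ ≋-refl
≋0ᴾ⊎degree (a ∷ p) with ≋0ᴾ⊎degree p
... | inj₂ (d , p_d≢0 , p-vanishes) = inj₂ (suc d , p_d≢0 , λ { zero () ; (suc k) (s≤s d<k) → p-vanishes k d<k })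
... | inj₁ p≋0 with a ℤₚ.≟ 0ℤ
...   | yes a≡0 = inj₁ (mk≋ λ { zero → a≡0 ; (suc k) → coeff-≡ p≋0 k })
...   | no  a≢0 = inj₂ (0 , a≢0 , λ { zero () ; (suc k) _ → coeff-≡ p≋0 k })

unit⇒constant : ∀ u v → u *ᴾ v ≋ 1ᴾ → VanishesAbove u 0
unit⇒constant u v uv≋1 with ≋0ᴾ⊎degree u | ≋0ᴾ⊎degree v
... | inj₁ u≋0 | _        = ⊥-elim (1≢0 (trans (sym (coeff-≡ uv≋1 0)) (coeff-≡ (≋0ᴾ⇒*ᴾ≋0ᴾ u v u≋0) 0)))
... | inj₂ _   | inj₁ v≋0 = ⊥-elim (1≢0 (trans (sym (coeff-≡ uv≋1 0))
                                         (coeff-≡ (≋-trans (*ᴾ-comm u v) (≋0ᴾ⇒*ᴾ≋0ᴾ v u v≋0)) 0)))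
... | inj₂ (zero , _ , u-vanishes) | inj₂ _ = u-vanishes
... | inj₂ (suc i , uᵢ≢0 , u-vanishes) | inj₂ (j , vⱼ≢0 , v-vanishes) =
  ⊥-elim (uᵢvⱼ≢0 (trans (sym (coeff-*ᴾ-top u v (suc i) j u-vanishes v-vanishes)) (coeff-≡ uv≋1 (suc (i + j)))))
  where
  uᵢvⱼ≢0 : coeff u (suc i) *ℤ coeff v j ≢ 0ℤ
  uᵢvⱼ≢0 uᵢvⱼ≡0 = [ uᵢ≢0 , vⱼ≢0 ]′ (ℤₚ.i*j≡0⇒i≡0∨j≡0 (coeff u (suc i)) uᵢvⱼ≡0)

bezout-cofactor : ∀ {N D N₁ D₁} → Bezout (N , D) → N₁ *ᴾ D ≋ D₁ *ᴾ N →
                  Σ ℕ λ k → Σ Poly λ E → qᴾ^ k *ᴾ N₁ ≋ N *ᴾ E × qᴾ^ k *ᴾ D₁ ≋ D *ᴾ E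
bezout-cofactor {N} {D} {N₁} {D₁} bezout N₁D≋D₁N = k , a *ᴾ D₁ -ᴾ c *ᴾ N₁ , qᵏN₁≋NE , qᵏD₁≋DE
  where
  open Bezout bezout
  open ≋-Reasoning
  qᵏN₁≋NE : qᴾ^ k *ᴾ N₁ ≋ N *ᴾ (a *ᴾ D₁ -ᴾ c *ᴾ N₁)
  qᵏN₁≋NE = begin
    qᴾ^ k *ᴾ N₁
      ≈⟨ *ᴾ-congʳ N₁ identity ⟨
    (a *ᴾ D -ᴾ c *ᴾ N) *ᴾ N₁
      ≈⟨ solve 5 (λ a c N D N₁ → (a :* D :- c :* N) :* N₁ := a :* (N₁ :* D) :- c :* (N :* N₁)) ≋-refl a c N D N₁ ⟩
    a *ᴾ (N₁ *ᴾ D) -ᴾ c *ᴾ (N *ᴾ N₁)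
      ≈⟨ +ᴾ-cong (*ᴾ-congˡ a N₁D≋D₁N) ≋-refl ⟩
    a *ᴾ (D₁ *ᴾ N) -ᴾ c *ᴾ (N *ᴾ N₁)
      ≈⟨ solve 5 (λ a c N N₁ D₁ → a :* (D₁ :* N) :- c :* (N :* N₁) := N :* (a :* D₁ :- c :* N₁)) ≋-refl a c N N₁ D₁ ⟩
    N *ᴾ (a *ᴾ D₁ -ᴾ c *ᴾ N₁)
      ∎
  qᵏD₁≋DE : qᴾ^ k *ᴾ D₁ ≋ D *ᴾ (a *ᴾ D₁ -ᴾ c *ᴾ N₁)
  qᵏD₁≋DE = begin
    qᴾ^ k *ᴾ D₁
      ≈⟨ *ᴾ-congʳ D₁ identity ⟨
    (a *ᴾ D -ᴾ c *ᴾ N) *ᴾ D₁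
      ≈⟨ solve 5 (λ a c N D D₁ → (a :* D :- c :* N) :* D₁ := a :* (D :* D₁) :- c :* (D₁ :* N)) ≋-refl a c N D D₁ ⟩
    a *ᴾ (D *ᴾ D₁) -ᴾ c *ᴾ (D₁ *ᴾ N)
      ≈⟨ +ᴾ-cong ≋-refl (-ᴾ-cong (*ᴾ-congˡ c N₁D≋D₁N)) ⟨
    a *ᴾ (D *ᴾ D₁) -ᴾ c *ᴾ (N₁ *ᴾ D)
      ≈⟨ solve 5 (λ a c D N₁ D₁ → a :* (D :* D₁) :- c :* (N₁ :* D) := D :* (a :* D₁ :- c :* N₁)) ≋-refl a c D N₁ D₁ ⟩
    D *ᴾ (a *ᴾ D₁ -ᴾ c *ᴾ N₁)
      ∎

common-factor≋1ᴾ : ∀ {N D N₁ D₁ E} → Coprimeᴾ N₁ D₁ → N₁ ≋ N *ᴾ E → D₁ ≋ D *ᴾ E →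
                   coeff D 0 ≡ 1ℤ → coeff D₁ 0 ≡ 1ℤ → E ≋ 1ᴾ
common-factor≋1ᴾ {N} {D} {N₁} {D₁} {E} N₁⊥D₁ N₁≋NE D₁≋DE D₀≡1 D₁₀≡1 = mk≋ λ
  { zero    → trans (sym (coeff-*ᴾ-zero-monic D E D₀≡1)) (trans (sym (coeff-≡ D₁≋DE 0)) D₁₀≡1)
  ; (suc k) → unit⇒constant E (proj₁ E∣1) (mk≋ (proj₂ E∣1)) (suc k) (s≤s z≤n) }
  where
  E∣1 : E ∣ᴾ 1ᴾ
  E∣1 = N₁⊥D₁ E (N , coeff-≡ (≋-trans (*ᴾ-comm E N) (≋-sym N₁≋NE)))
                (D , coeff-≡ (≋-trans (*ᴾ-comm E D) (≋-sym D₁≋DE)))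

u≋1ᴾ⇒p*ᴾu≋p : ∀ p {u} → u ≋ 1ᴾ → p *ᴾ u ≋ p
u≋1ᴾ⇒p*ᴾu≋p p u≋1 = ≋-trans (*ᴾ-congˡ p u≋1) (≋-trans (*ᴾ-comm p 1ᴾ) (*ᴾ-identityˡ p))

reduced-unique : ∀ {N D N₁ D₁} → Bezout (N , D) → coeff D 0 ≡ 1ℤ → N₁ *ᴾ D ≋ D₁ *ᴾ N →
                 Coprimeᴾ N₁ D₁ → coeff D₁ 0 ≡ 1ℤ → N₁ ≋ N × D₁ ≋ D
reduced-unique {N} {D} {N₁} {D₁} bezout D₀≡1 N₁D≋D₁N N₁⊥D₁ D₁₀≡1 =
  let k , E , qᵏN₁≋NE , qᵏD₁≋DE = bezout-cofactor bezout N₁D≋D₁N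
      E′ , N₁≋NE′ , D₁≋DE′      = divide-qᴾ^ k {N} {D} E D₀≡1 qᵏN₁≋NE qᵏD₁≋DE
      E′≋1                     = common-factor≋1ᴾ {N} {D} N₁⊥D₁ N₁≋NE′ D₁≋DE′ D₀≡1 D₁₀≡1
  in ≋-trans N₁≋NE′ (u≋1ᴾ⇒p*ᴾu≋p N E′≋1) , ≋-trans D₁≋DE′ (u≋1ᴾ⇒p*ᴾu≋p D E′≋1)

cross-multiply : ∀ a {N D P Q N′ D′} → (P , Q) ≋₂ -qᴾ^ a · (N′ , D′) → N *ᴾ Q ≋ D *ᴾ P → N *ᴾ D′ ≋ D *ᴾ N′
cross-multiply a {N} {D} {P} {Q} {N′} {D′} (P≋ ,≋ Q≋) NQ≋DP = -qᴾ^-*ᴾ-cancelˡ a (N *ᴾ D′) (D *ᴾ N′) (begin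
  c *ᴾ (N *ᴾ D′)   ≈⟨ solve 3 (λ c N D′ → c :* (N :* D′) := N :* (c :* D′)) ≋-refl c N D′ ⟩
  N *ᴾ (c *ᴾ D′)   ≈⟨ *ᴾ-congˡ N Q≋ ⟨
  N *ᴾ Q           ≈⟨ NQ≋DP ⟩
  D *ᴾ P           ≈⟨ *ᴾ-congˡ D P≋ ⟩
  D *ᴾ (c *ᴾ N′)   ≈⟨ solve 3 (λ c D N′ → D :* (c :* N′) := c :* (D :* N′)) ≋-refl c D N′ ⟩
  c *ᴾ (D *ᴾ N′)   ∎)
  where
  open ≋-Reasoning
  c = -qᴾ^ a

numDen≋reduced : ∀ {p d N D} → 1 ≤ p → 1 ≤ d → Coprime p d → IsNumDen p d N D → (N , D) ≋₂ reduced p d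
numDen≋reduced {p} {d} {N} {D} 1≤p 1≤d p⊥d (NQ≈DP , N⊥D , D₀≡1) =
  let N≋ , D≋ = reduced-unique (bezout-reduced p d) (Shape.D-bottom (shape-qPair p d))
                  (cross-multiply (proj₁ computed) {N} {D} qrat≋ (mk≋ NQ≈DP)) N⊥D D₀≡1
  in N≋ ,≋ D≋
  where
  computed = go-reduced (suc d) p d 1≤d ℕₚ.≤-refl p⊥d
  qrat≋ : qrat p d ≋₂ -qᴾ^ proj₁ computed · reduced p d
  qrat≋ = subst (λ x → qrat p d ≋₂ -qᴾ^ proj₁ computed · x) (reduced₀-suc d 1≤p) (proj₂ computed)

monicPositive : ∀ {p d} → MonicPositiveUpTo p d → MonicPositive p
monicPositive {p} {d} M = d , (1≢0 ∘ trans (sym top) , vanishes positiveBetween) , top , bottom ,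
                          (λ k k≤d → positive positiveBetween k z≤n k≤d)
  where open MonicPositiveUpTo M

selfReciprocal : ∀ {p d} → MonicPositiveUpTo p d → Reversal d p p → SelfReciprocal p
selfReciprocal {p} {d} M R = d , (1≢0 ∘ trans (sym top) , vanishes positiveBetween) , reverses R
  where open MonicPositiveUpTo M

monicPositive-resp-≋ : ∀ {p p′} → p ≋ p′ → MonicPositive p → MonicPositive p′
monicPositive-resp-≋ (mk≋ p≈p′) (d , (p_d≢0 , p-vanishes) , top , bottom , p>0) =
  d , (p_d≢0 ∘ trans (p≈p′ d) , λ k d<k → trans (sym (p≈p′ k)) (p-vanishes k d<k)) ,
  trans (sym (p≈p′ d)) top , trans (sym (p≈p′ 0)) bottom , (λ k k≤d → subst (0ℤ ℤ.<_) (p≈p′ k) (p>0 k k≤d))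

selfReciprocal-resp-≋ : ∀ {p p′} → p ≋ p′ → SelfReciprocal p → SelfReciprocal p′
selfReciprocal-resp-≋ (mk≋ p≈p′) (d , (p_d≢0 , p-vanishes) , palindromic) =
  d , (p_d≢0 ∘ trans (p≈p′ d) , λ k d<k → trans (sym (p≈p′ k)) (p-vanishes k d<k)) ,
  (λ k k≤d → trans (sym (p≈p′ k)) (trans (palindromic k k≤d) (p≈p′ (d ∸ k))))

monicPositive-qNN̄+DD̄ : ∀ {N D N̄ D̄ l l̄ e ē h h̄} →
  PositiveBetween N l e → coeff N e ≡ 1ℤ → PositiveBetween N̄ l̄ ē → coeff N̄ ē ≡ 1ℤ →
  PositiveBetween D 0 h → coeff D 0 ≡ 1ℤ → PositiveBetween D̄ 0 h̄ → coeff D̄ 0 ≡ 1ℤ →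
  l ≤ e → l̄ ≤ ē → l + l̄ ≤ h + h̄ → h + h̄ ≤ e + ē →
  MonicPositiveUpTo (qᴾ *ᴾ (N *ᴾ N̄) +ᴾ D *ᴾ D̄) (suc (e + ē))
monicPositive-qNN̄+DD̄ {N} {D} {N̄} {D̄} {e = e} {ē}
                      N>0 N-top N̄>0 N̄-top D>0 D-bottom D̄>0 D̄-bottom l≤e l̄≤ē low high =
  monicPositive-qᴾ-*ᴾ-+ᴾ (positiveBetween-*ᴾ l≤e l̄≤ē N>0 N̄>0)
    (trans (coeff-*ᴾ-top N N̄ e ē (vanishes N>0) (vanishes N̄>0)) (cong₂ _*ℤ_ N-top N̄-top))
    (positiveBetween-*ᴾ z≤n z≤n D>0 D̄>0) (trans (coeff-*ᴾ-zero D D̄) (cong₂ _*ℤ_ D-bottom D̄-bottom)) low high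

module _ {N D N̄ D̄} (sh : Shape N D N̄ D̄) where
  open Shape sh

  𝒜-palindromic : Reversal (suc (e + e)) (qᴾ *ᴾ (N *ᴾ N̄) +ᴾ D *ᴾ D̄) (qᴾ *ᴾ (N *ᴾ N̄) +ᴾ D *ᴾ D̄)
  𝒜-palindromic = reversal-resp-≋ ≋-refl (+ᴾ-comm (D *ᴾ D̄) (qᴾ *ᴾ (N *ᴾ N̄)))
    (reversal-+ᴾ (reversal-qᴾ-*ᴾˡ NN̄-reversal-DD̄) (reversal-qᴾ-*ᴾʳ (reversal-sym NN̄-reversal-DD̄)))

  ℬ-palindromic : Reversal (e + e) (ℬ N D N̄ D̄) (ℬ N D N̄ D̄)
  ℬ-palindromic = reversal-+ᴾ ND̄-palindromic (reversal-negᴾ DN̄-palindromic)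

  𝒜-monicPositive : ℓ ≡ 0 → MonicPositiveUpTo (qᴾ *ᴾ (N *ᴾ N̄) +ᴾ D *ᴾ D̄) (suc (e + e))
  𝒜-monicPositive refl = monicPositive-qNN̄+DD̄ N-positive N-top N̄-positive N̄-top D-positive D-bottom
    D̄-positive D̄-bottom z≤n ℓ̄≤e (ℕₚ.≤-trans ℓ̄≤e (ℕₚ.m≤n+m e (e ∸ ℓ̄))) (ℕₚ.+-monoˡ-≤ e (ℕₚ.m∸n≤m e ℓ̄))

  𝒞-monicPositive : ℓ ≡ 0 → MonicPositiveUpTo (qᴾ *ᴾ (N *ᴾ N) +ᴾ D *ᴾ D) (suc (e + e))
  𝒞-monicPositive refl = monicPositive-qNN̄+DD̄ N-positive N-top N-positive N-top D-positive D-bottom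
    D-positive D-bottom z≤n z≤n z≤n (ℕₚ.+-mono-≤ (ℕₚ.m∸n≤m e ℓ̄) (ℕₚ.m∸n≤m e ℓ̄))

  ℬ-monicPositive-step : MonicPositiveUpTo (qᴾ *ᴾ (qᴾ *ᴾ (N *ᴾ N̄) +ᴾ N *ᴾ D̄) +ᴾ D *ᴾ D̄) (suc (suc (e + e)))
  ℬ-monicPositive-step = monicPositive-qᴾ-*ᴾ-+ᴾ qNN̄+ND̄ qNN̄+ND̄-top
    (positiveBetween-*ᴾ z≤n z≤n D-positive D̄-positive) (trans (coeff-*ᴾ-zero D D̄) (cong₂ _*ℤ_ D-bottom D̄-bottom))
    (ℕₚ.≤-trans (ℕₚ.≤-reflexive (ℕₚ.+-identityʳ ℓ)) (ℕₚ.≤-trans ℓ≤e∸ℓ̄ (ℕₚ.m≤m+n (e ∸ ℓ̄) (e ∸ ℓ))))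
    (ℕₚ.m≤n⇒m≤1+n (ℕₚ.+-mono-≤ (ℕₚ.m∸n≤m e ℓ̄) (ℕₚ.m∸n≤m e ℓ)))
    where
    ND̄ = positiveBetween-*ᴾ ℓ≤e z≤n N-positive D̄-positive
    qNN̄+ND̄ : PositiveBetween (qᴾ *ᴾ (N *ᴾ N̄) +ᴾ N *ᴾ D̄) (ℓ + 0) (suc (e + e))
    qNN̄+ND̄ = positiveBetween-+ᴾ (positiveBetween-qᴾ-*ᴾ (positiveBetween-*ᴾ ℓ≤e ℓ̄≤e N-positive N̄-positive)) ND̄
      (ℕₚ.≤-trans (ℕₚ.≤-reflexive (ℕₚ.+-identityʳ ℓ)) (ℕₚ.m≤n⇒m≤1+n (ℕₚ.m≤m+n ℓ ℓ̄)))
      (s≤s (ℕₚ.≤-trans ℓ+ℓ̄≤e (ℕₚ.m≤m+n e (e ∸ ℓ))))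
      (ℕₚ.m≤n⇒m≤1+n (ℕₚ.+-monoʳ-≤ e (ℕₚ.m∸n≤m e ℓ)))
    qNN̄+ND̄-top : coeff (qᴾ *ᴾ (N *ᴾ N̄) +ᴾ N *ᴾ D̄) (suc (e + e)) ≡ 1ℤ
    qNN̄+ND̄-top = trans (coeff-+ᴾ (qᴾ *ᴾ (N *ᴾ N̄)) (N *ᴾ D̄) (suc (e + e)))
      (cong₂ _+ℤ_ (trans (coeff-qᴾ-*ᴾ-suc (N *ᴾ N̄) (e + e))
                         (trans (coeff-*ᴾ-top N N̄ e e (vanishes N-positive) (vanishes N̄-positive))
                                (cong₂ _*ℤ_ N-top N̄-top)))
                  (vanishes ND̄ (suc (e + e)) (s≤s (ℕₚ.+-monoʳ-≤ e (ℕₚ.m∸n≤m e ℓ)))))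

𝒜ℬ𝒞-Properties : RatFun → RatFun → Set
𝒜ℬ𝒞-Properties (N₁ , D₁) (N₂ , D₂) =
  (SelfReciprocal (𝒜 N₁ D₁ N₂ D₂) × SelfReciprocal (ℬ N₁ D₁ N₂ D₂))
  × (MonicPositive (𝒜 N₁ D₁ N₂ D₂) × MonicPositive (ℬ N₁ D₁ N₂ D₂) × MonicPositive (𝒞 N₁ D₁))

𝒜ℬ𝒞-Properties-resp-≋₂ : ∀ {x x′ y y′} → x ≋₂ x′ → y ≋₂ y′ → 𝒜ℬ𝒞-Properties x y → 𝒜ℬ𝒞-Properties x′ y′
𝒜ℬ𝒞-Properties-resp-≋₂ (N₁≋ ,≋ D₁≋) (N₂≋ ,≋ D₂≋) ((𝒜-sr , ℬ-sr) , (𝒜-mp , ℬ-mp , 𝒞-mp)) =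
  (selfReciprocal-resp-≋ 𝒜≋ 𝒜-sr , selfReciprocal-resp-≋ ℬ≋ ℬ-sr) ,
  (monicPositive-resp-≋ 𝒜≋ 𝒜-mp , monicPositive-resp-≋ ℬ≋ ℬ-mp , monicPositive-resp-≋ 𝒞≋ 𝒞-mp)
  where
  𝒜≋ = +ᴾ-cong (qᴾ*-cong (*ᴾ-cong N₁≋ N₂≋)) (*ᴾ-cong D₁≋ D₂≋)
  ℬ≋ = +ᴾ-cong (*ᴾ-cong N₁≋ D₂≋) (-ᴾ-cong (*ᴾ-cong D₁≋ N₂≋))
  𝒞≋ = +ᴾ-cong (qᴾ*-cong (*ᴾ-cong N₁≋ N₁≋)) (*ᴾ-cong D₁≋ D₁≋)

𝒜ℬ𝒞-properties-step : ∀ {s} → ShapeOf s → 𝒜ℬ𝒞-Properties (proj₁ (step s)) (proj₂ (step s))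
𝒜ℬ𝒞-properties-step {(N₀ , D₀) , (N̄₀ , D̄₀)} sh₀ =
  (selfReciprocal-resp-≋ 𝒜≋ (selfReciprocal (𝒜-monicPositive sh refl) (𝒜-palindromic sh)) ,
   selfReciprocal-resp-≋ ℬ≋ (selfReciprocal (ℬ-monicPositive-step sh₀) B′-palindromic)) ,
  (monicPositive-resp-≋ 𝒜≋ (monicPositive (𝒜-monicPositive sh refl)) ,
   monicPositive-resp-≋ ℬ≋ (monicPositive (ℬ-monicPositive-step sh₀)) ,
   monicPositive-resp-≋ 𝒞≋ (monicPositive (𝒞-monicPositive sh refl)))
  where
  sh = shape-step {(N₀ , D₀) , (N̄₀ , D̄₀)} sh₀
  N = qᴾ *ᴾ N₀ +ᴾ D₀
  N̄ = qᴾ *ᴾ N̄₀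
  D̄ = qᴾ *ᴾ N̄₀ +ᴾ D̄₀
  𝒜≋ : qᴾ *ᴾ (N *ᴾ N̄) +ᴾ D₀ *ᴾ D̄ ≋ 𝒜 N D₀ N̄ D̄
  𝒜≋ = +ᴾ-cong (≋-sym (qᴾ*≋qᴾ-*ᴾ (N *ᴾ N̄))) ≋-refl
  𝒞≋ : qᴾ *ᴾ (N *ᴾ N) +ᴾ D₀ *ᴾ D₀ ≋ 𝒞 N D₀
  𝒞≋ = +ᴾ-cong (≋-sym (qᴾ*≋qᴾ-*ᴾ (N *ᴾ N))) ≋-refl
  B′ = qᴾ *ᴾ (qᴾ *ᴾ (N₀ *ᴾ N̄₀) +ᴾ N₀ *ᴾ D̄₀) +ᴾ D₀ *ᴾ D̄₀
  ℬ≋ : B′ ≋ ℬ N D₀ N̄ D̄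
  ℬ≋ = solve 5 (λ q N₀ D₀ N̄₀ D̄₀ → q :* (q :* (N₀ :* N̄₀) :+ N₀ :* D̄₀) :+ D₀ :* D̄₀
                                  := (q :* N₀ :+ D₀) :* (q :* N̄₀ :+ D̄₀) :- D₀ :* (q :* N̄₀)) ≋-refl qᴾ N₀ D₀ N̄₀ D̄₀
  e₀ = Shape.e sh₀
  B′-palindromic : Reversal (suc (suc (e₀ + e₀))) B′ B′
  B′-palindromic = subst (λ n → Reversal n B′ B′) (cong suc (ℕₚ.+-suc e₀ e₀))
                     (reversal-resp-≋ (≋-sym ℬ≋) (≋-sym ℬ≋) (ℬ-palindromic sh))

proposition2 : (m n : ℕ) → Coprime m n → 1 ≤ n → n < m →
    (N₁ D₁ N₂ D₂ : Poly) → IsNumDen m n N₁ D₁ → IsNumDen n m N₂ D₂ →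
    (SelfReciprocal (𝒜 N₁ D₁ N₂ D₂) × SelfReciprocal (ℬ N₁ D₁ N₂ D₂))
    × (MonicPositive (𝒜 N₁ D₁ N₂ D₂) × MonicPositive (ℬ N₁ D₁ N₂ D₂)
       × MonicPositive (𝒞 N₁ D₁))
proposition2 m n m⊥n 1≤n n<m N₁ D₁ N₂ D₂ m/n n/m =
  𝒜ℬ𝒞-Properties-resp-≋₂ {x′ = N₁ , D₁} {y′ = N₂ , D₂} (≋₂-sym (numDen≋reduced 1≤m 1≤n m⊥n m/n))
                         (≋₂-sym (numDen≋reduced 1≤n 1≤m (Coprime-sym m⊥n) n/m))
                         (subst₂ 𝒜ℬ𝒞-Properties (cong proj₁ qPair≡) (trans (cong proj₂ qPair≡) (reduced-swap 1≤m 1≤n))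
                                 (𝒜ℬ𝒞-properties-step (shape-qPair (m ∸ n) n)))
  where
  1≤m : 1 ≤ m
  1≤m = ℕₚ.≤-trans 1≤n (ℕₚ.<⇒≤ n<m)
  qPair≡ : step (qPair (m ∸ n) n) ≡ qPair m n
  qPair≡ = sym (qPair-> 1≤n n<m)
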